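{- Let $k\ge2$. There exist constants $c>0$ and $N$ such that for all $n\ge N$, the complex $\Lambda^{2k-1}_{n-2}:=\mathrm{lk}(\{1,2\},\Delta^{2k+1}_n)$ has at least $c\,n^{k-1}$ faces of dimension $2k-3$ whose links in $\Lambda^{2k-1}_{n-2}$ have at least $2(n-3k+1)$ vertices.
   Context: Simplicial complexes are finite abstract simplicial complexes; $\overline{A}$ is the simplex of all subsets of a finite set $A$; $\mathrm{lk}(\tau,\Delta)=\{\sigma\in\Delta:\sigma\cap\tau=\emptyset,\sigma\cup\tau\in\Delta\}$. $V_m=\{\pm1,\dots,\pm m\}$; $-\sigma=\{ -v:v\in\sigma\}$, $-\Gamma=\{ -\sigma:\sigma\in\Gamma\}$. The join is $\Gamma*\Gamma'=\{\sigma\cup\tau\}$, $\Gamma*v:=\Gamma*\overline{\{v\}}$; a path/cycle $(v_1,\dots,v_m)$ is the 1-dimensional complex with edges $\{v_j,v_{j+1}\}$. $\partial C^*_m$ is the complex of all subsets of $V_m$ with no pair $\{j,-j\}$. For pure $\Delta$ and pure full-dimensional subcomplex $\Gamma$, $\Delta\setminus\Gamma$ is generated by facets of $\Delta$ not in $\Gamma$; $\partial B$ is the boundary complex of a combinatorial ball $B$. Recursive definition: $\Delta^1_n=(1,\dots,n,-1,\dots,-n,1)$; $\Delta^d_{d+1}=\partial C^*_{d+1}$; $B^{d,j}_n=\emptyset$ for $j<0$; $B^{1,0}_n=\overline{\{ -1,n\}}$; $B^{2k-1,k}_n=\Delta^{2k-1}_n\setminus B^{2k-1,k-1}_n$ ($k\ge1$,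 $n\ge 2k$); $B^{d,i}_n=(B^{d-1,i}_{n-1}*n)\cup((-B^{d-1,i-1}_{n-1})*(-n))$ ($d\ge2$, $n\ge d+1$, $i\le\lfloor d/2\rfloor$); $\Delta^d_{n+1}$ is obtained from $\Delta^d_n$ by replacing $B=B^{d,\lceil d/2\rceil-1}_n$ with $\partial B*(n+1)$ and $-B$ with $\partial(-B)*(-n-1)$ (known to be well defined). -}

module Defs where

open import Data.Nat as ℕ using (ℕ; zero; suc; _≤_; _∸_; _≤ᵇ_; _≡ᵇ_; ⌊_/2⌋; ⌈_/2⌉)
open import Data.Integer as ℤ using (ℤ; +_; -_; ∣_∣)
open import Data.Bool using (if_then_else_)
open import Data.List using (List; []; _∷_; [_]; _++_; map; concat; upTo)
open import Data.List.Membership.Propositional using (_∈_; _∉_)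
open import Data.List.Relation.Binary.Subset.Propositional using (_⊆_)
open import Data.List.Relation.Unary.Any using (Any)
open import Data.Product using (Σ; _×_)
open import Data.Sum using (_⊎_)
open import Data.Empty using (⊥)
open import Relation.Nullary using (¬_)
open import Relation.Binary.PropositionalEquality using (_≢_)

-- A face is a finite set of (nonzero) integer vertices, represented by a list
-- (all notions below only use the list as a set, via ⊆ / ∈).
Face : Set
Face = List ℤ

Cx : Set₁
Cx = Face → Set

-- the void complex (no faces at all); this is the ∅ of "B^{d,j}_n = ∅ for j<0"
void : Cx
void _ = ⊥

gen : List Face → Cx
gen Fs σ = Any (σ ⊆_) Fs

simplex : Face → Cx
simplex A = gen [ A ]

vtx : ℤ → Cx
vtx v = simplex [ v ]

_≋_ : Face → Face → Set
σ ≋ τ = σ ⊆ τ × τ ⊆ σ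

neg : Cx → Cx
neg Γ σ = Γ (map -_ σ)

join : Cx → Cx → Cx
join Γ Γ' σ = Σ Face λ τ → Σ Face λ τ' → Γ τ × Γ' τ' × σ ≋ (τ ++ τ')

union : Cx → Cx → Cx
union Γ Γ' σ = Γ σ ⊎ Γ' σ

Facet : Cx → Face → Set
Facet Γ F = Γ F × ((G : Face) → Γ G → F ⊆ G → G ⊆ F)

minus : Cx → Cx → Cx
minus Δ Γ σ = Σ Face λ F → Facet Δ F × ¬ Γ F × σ ⊆ F

-- boundary complex of a (pure) combinatorial ball B: generated by the ridges
-- (codimension-one faces τ = F \ {x} of facets F) lying in exactly one facet of B
bdry : Cx → Cx
bdry B σ = Σ Face λ F → Σ ℤ λ x → Σ Face λ τ →
  Facet B F × x ∈ F × x ∉ τ × τ ⊆ F × F ⊆ (x ∷ τ) ×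
  ((G : Face) → Facet B G → τ ⊆ G → G ≋ F) × σ ⊆ τ

lk : Face → Cx → Cx
lk τ Δ σ = ((v : ℤ) → v ∈ σ → v ∉ τ) × Δ (σ ++ τ)

crossBdry : ℕ → Cx
crossBdry m σ = ((v : ℤ) → v ∈ σ → 1 ≤ ∣ v ∣ × ∣ v ∣ ≤ m) × ((v : ℤ) → v ∈ σ → - v ∉ σ)

-- Δ^1_n : the cycle (1,…,n,-1,…,-n,1)
cycEdges : ℕ → List Face
cycEdges n = (+ n ∷ - (+ 1) ∷ []) ∷ (- (+ n) ∷ + 1 ∷ []) ∷
  concat (map (λ j → (+ suc j ∷ + suc (suc j) ∷ [])
                    ∷ (- (+ suc j) ∷ - (+ suc (suc j)) ∷ []) ∷ []) (upTo (n ∸ 1)))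

cycle : ℕ → Cx
cycle n = gen (cycEdges n)

replaceStep : Cx → Cx → ℕ → Cx
replaceStep Δ B v =
  union (minus Δ (union B (neg B)))
        (union (join (bdry B) (vtx (+ v))) (join (bdry (neg B)) (vtx (- (+ v)))))

-- ΔIt d Bd t = Δ^d_{d+1+t}, given the family Bd m = B^{d,⌈d/2⌉-1}_m
ΔIt : ℕ → (ℕ → Cx) → ℕ → Cx
ΔIt d Bd zero = crossBdry (suc d)
ΔIt d Bd (suc t) = replaceStep (ΔIt d Bd t) (Bd (suc d ℕ.+ t)) (suc (suc d ℕ.+ t))

-- Δ^d_n for d ≥ 2 (void/junk when n < d+1, where it is undefined)
Δgen : ℕ → (ℕ → Cx) → ℕ → Cx
Δgen d Bd n = if suc d ≤ᵇ n then ΔIt d Bd (n ∸ suc d) else void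

-- B^{d,i}_n = (B^{d-1,i}_{n-1} * n) ∪ ((-B^{d-1,i-1}_{n-1}) * (-n)),
-- given the family Bd' i m = B^{d-1,i}_m  (B^{d-1,j} = ∅ for j < 0)
Brule : (ℕ → ℕ → Cx) → ℕ → ℕ → Cx
Brule Bd' i n = union (join (Bd' i (n ∸ 1)) (vtx (+ n)))
                      (join (neg (prev i (n ∸ 1))) (vtx (- (+ n))))
  where
  prev : ℕ → ℕ → Cx
  prev zero m = void
  prev (suc i) m = Bd' i m

-- Bfam d i n = B^{d,i}_n  (junk = void outside the range of the definition)
Bfam : ℕ → ℕ → ℕ → Cx
Bfam zero i n = void
Bfam (suc zero) zero n = simplex (- (+ 1) ∷ + n ∷ [])
Bfam (suc zero) (suc zero) n = minus (cycle n) (simplex (- (+ 1) ∷ + n ∷ []))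
Bfam (suc zero) (suc (suc i)) n = void
Bfam (suc (suc e)) i n =
  if i ≤ᵇ ⌊ suc (suc e) /2⌋ then Brule (Bfam (suc e)) i n
  else (if i ≡ᵇ ⌈ suc (suc e) /2⌉
        -- d = 2k-1 odd, i = k : B^{d,k}_n = Δ^d_n \ B^{d,k-1}_n  (k-1 = ⌊d/2⌋ = ⌈d/2⌉-1)
        then minus (Δgen (suc (suc e)) (Brule (Bfam (suc e)) ⌊ suc (suc e) /2⌋) n)
                   (Brule (Bfam (suc e)) ⌊ suc (suc e) /2⌋ n)
        else void)

Δc : ℕ → ℕ → Cx
Δc zero n = void
Δc (suc zero) n = cycle n
Δc (suc (suc e)) n = Δgen (suc (suc e)) (Bfam (suc (suc e)) (⌈ suc (suc e) /2⌉ ∸ 1)) n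

Λ : ℕ → ℕ → Cx
Λ k n = lk (+ 1 ∷ + 2 ∷ []) (Δc (suc (2 ℕ.* k)) n)

-- Write k = r + 1. For a list of pairs (e_i , a_i) whose starts decrease by at least 3 and stay
-- above 2, the face {e_i (a_i + 2), e_i a_i} ∪ ±{2, 1} is a facet of B^{2r+1,r+1}_m (induction on r),
-- and for n ≥ a_1 + 2 a facet of Δ^{2r+3}_n: it appears at vertex a_1 + 2 as a cone over a boundary
-- face of ±B^{2r+3,r+1}_{a_1+1} and is never removed, because a facet of a later ball B_m has
-- vertices of absolute value m and m - 1. Hence, for starts a_i of gap at least 7, the 2r vertices
-- {a_i + 2, a_i} form a face σ of Λ = lk({1,2}, Δ^{2k+1}_n), and each w ∈ [3, n] outside the sets
-- {a_i, a_i + 1, a_i + 2} contributes link vertices ±w by inserting a pair through w; there are at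
-- least n - 3r - 2 such w. Taking the i-th start from a block of L = ⌊n / 14r⌋ candidates gives
-- L^r ≥ (n / 28r)^r distinct faces σ.

module Submission where

open import Defs
open import Data.Nat using (ℕ; _≤_; _<_; _*_; _^_; _∸_; _+_)
open import Data.Integer using (ℤ)
open import Data.List using (List; length; [_]; _∷_)
open import Data.List.Relation.Unary.All using (All)
open import Data.List.Relation.Unary.AllPairs using (AllPairs)
open import Data.List.Relation.Unary.Unique.Propositional using (Unique)
open import Data.Product using (Σ; _×_)
open import Relation.Nullary using (¬_)
open import Relation.Binary.PropositionalEquality using (_≡_)

open import Data.Nat using (zero; suc; z≤n; s≤s; z<s; _≤ᵇ_; _≡ᵇ_; ⌊_/2⌋; ⌈_/2⌉)
import Data.Nat as ℕ
import Data.Nat.Properties as ℕₚ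
open import Data.Integer using (+_; -_; ∣_∣)
import Data.Integer as ℤ
import Data.Integer.Properties as ℤₚ
open import Data.List using ([]; _++_; map; filter; concat; applyUpTo; upTo; applyDownFrom; cartesianProductWith)
open import Data.List.Properties using (length-map; length-++; length-applyUpTo; length-applyDownFrom; length-upTo; ∷-injective; map-∘; map-cong; map-id; filter-notAll)
open import Data.List.Relation.Unary.All using ([]; _∷_)
import Data.List.Relation.Unary.All as All
open import Data.List.Relation.Unary.All.Properties using (¬All⇒Any¬)
import Data.List.Relation.Unary.All.Properties as Allₚ
open import Data.List.Relation.Unary.AllPairs using ([]; _∷_)
open import Data.List.Relation.Unary.Any using (Any; here; there)
import Data.List.Relation.Unary.Any as Any
import Data.List.Relation.Unary.Any.Properties as Anyₚ
import Data.List.Relation.Unary.Unique.Propositional.Properties as Uniqueₚ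
import Data.List.Relation.Unary.AllPairs as AllPairs
import Data.List.Relation.Unary.AllPairs.Properties as AllPairsₚ
open import Data.List.Membership.Propositional using (_∈_; _∉_; find)
open import Data.List.Membership.Propositional.Properties
  using (∈-++⁺ˡ; ∈-++⁺ʳ; ∈-++⁻; ∈-map⁺; ∈-map⁻; ∈-filter⁺; ∈-filter⁻; ∈-applyUpTo⁺; ∈-applyDownFrom⁻; ∈-upTo⁻; ∈-cartesianProductWith⁻)
open import Data.List.Relation.Binary.Subset.Propositional using (_⊆_)
import Data.List.Relation.Binary.Subset.Propositional.Properties as ⊆ₚ
open import Data.Product using (_,_; proj₁; proj₂; ∃-syntax)
open import Data.Sum using (_⊎_; inj₁; inj₂)
open import Data.Empty using (⊥; ⊥-elim)
open import Data.Unit using (⊤; tt)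
open import Data.Bool using (Bool; true; false; not; T)
open import Relation.Nullary using (yes; no; ¬?)
open import Relation.Binary.PropositionalEquality using (refl; sym; trans; cong; cong₂; subst; subst₂; _≢_)
open import Relation.Binary.Definitions using (DecidableEquality)
open import Function using (_∘_; id)
open import Data.Nat.Tactic.RingSolver using (solve-∀)
open import Data.Nat.DivMod using (_/_; _%_; m/n*n≤m; m≥n⇒m/n>0; m≡m%n+[m/n]*n; m%n<n)

module FiniteSets {A : Set} (_≟_ : DecidableEquality A) where

  open import Data.List.Membership.DecPropositional _≟_ public using (_∈?_)

  delete : A → List A → List A
  delete x = filter (λ y → ¬? (y ≟ x))

  ∈-delete⁻ : ∀ {x y} xs → y ∈ delete x xs → y ∈ xs × y ≢ x
  ∈-delete⁻ {x} _ = ∈-filter⁻ (λ y → ¬? (y ≟ x))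

  ∈-delete⁺ : ∀ {x y xs} → y ∈ xs → y ≢ x → y ∈ delete x xs
  ∈-delete⁺ {x} = ∈-filter⁺ (λ y → ¬? (y ≟ x))

  Unique-delete : ∀ {x xs} → Unique xs → Unique (delete x xs)
  Unique-delete {x} = Uniqueₚ.filter⁺ (λ y → ¬? (y ≟ x))

  length-delete< : ∀ {x xs} → x ∈ xs → length (delete x xs) < length xs
  length-delete< {x} {xs} x∈ = filter-notAll (λ y → ¬? (y ≟ x)) xs (Any.map (λ { refl x≢x → x≢x refl }) x∈)

  Unique-∷ : ∀ {x : A} {xs} → x ∉ xs → Unique xs → Unique (x ∷ xs)
  Unique-∷ {xs = xs} x∉ u = All.tabulate (λ y∈ x≡y → x∉ (subst (_∈ xs) (sym x≡y) y∈)) ∷ u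

  Unique⇒length-mono : ∀ {U L : List A} → Unique U → U ⊆ L → length U ≤ length L
  Unique⇒length-mono {[]} _ _ = z≤n
  Unique⇒length-mono {x ∷ U} {L} (x∉U ∷ uU) U⊆L =
    ℕₚ.≤-trans (s≤s (Unique⇒length-mono uU U⊆L-x)) (length-delete< (U⊆L (here refl)))
    where
    U⊆L-x : U ⊆ delete x L
    U⊆L-x y∈ = ∈-delete⁺ (U⊆L (there y∈)) (λ { refl → All.lookup x∉U y∈ refl })

  length-delete : ∀ {x xs} → Unique xs → x ∈ xs → length xs ≡ suc (length (delete x xs))
  length-delete {x} {xs} u x∈ = ℕₚ.≤-antisym (Unique⇒length-mono u xs⊆) (length-delete< x∈)
    where
    xs⊆ : xs ⊆ x ∷ delete x xs
    xs⊆ {y} y∈ with y ≟ x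
    ... | yes y≡x = here y≡x
    ... | no y≢x = there (∈-delete⁺ y∈ y≢x)

  ⊆-maximal : ∀ {F G : List A} p → (∀ {U} → Unique U → U ⊆ G → length U ≤ p) →
              Unique F → length F ≡ p → F ⊆ G → G ⊆ F
  ⊆-maximal {F} p bound uF |F| F⊆G {y} y∈G with y ∈? F
  ... | yes y∈F = y∈F
  ... | no y∉F = ⊥-elim (ℕₚ.<-irrefl refl (subst (λ l → suc l ≤ p) |F|
          (bound (Unique-∷ y∉F uF) λ { (here refl) → y∈G ; (there q) → F⊆G q })))

  ⊆-or-∉ : ∀ G τ → G ⊆ τ ⊎ ∃[ y ] y ∈ G × y ∉ τ
  ⊆-or-∉ G τ with All.all? (_∈? τ) G
  ... | yes G⊆τ = inj₁ (All.lookup G⊆τ)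
  ... | no G⊈τ = inj₂ (find (¬All⇒Any¬ (_∈? τ) G G⊈τ))

open FiniteSets ℤ._≟_

-- Faces are lists that may repeat vertices, so their size is measured by duplicate-free sublists.
Rank≤ : ℕ → Cx → Set
Rank≤ p Γ = ∀ {σ U} → Γ σ → Unique U → U ⊆ σ → length U ≤ p

DownClosed : Cx → Set
DownClosed Γ = ∀ {σ ρ} → Γ σ → ρ ⊆ σ → Γ ρ

cone : Cx → ℤ → Cx
cone Γ v = join Γ (vtx v)

cone-elim : ∀ {Γ v σ} → cone Γ v σ → ∃[ τ ] Γ τ × (∀ {u} → u ∈ σ → u ≢ v → u ∈ τ)
cone-elim {v = v} {σ} (τ , τ' , Γτ , here τ'⊆v , σ⊆ , _) = τ , Γτ , base
  where
  base : ∀ {u} → u ∈ σ → u ≢ v → u ∈ τ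
  base u∈σ u≢v with ∈-++⁻ τ (σ⊆ u∈σ)
  ... | inj₁ u∈τ = u∈τ
  ... | inj₂ u∈τ' with τ'⊆v u∈τ'
  ...   | here u≡v = ⊥-elim (u≢v u≡v)

cone-intro : ∀ {Γ v σ} τ → Γ τ → σ ⊆ v ∷ τ → v ∷ τ ⊆ σ → cone Γ v σ
cone-intro {v = v} {σ} τ Γτ σ⊆ ⊆σ = τ , [ v ] , Γτ , here id , to , from
  where
  to : σ ⊆ τ ++ [ v ]
  to p with σ⊆ p
  ... | here u≡v = ∈-++⁺ʳ τ (here u≡v)
  ... | there u∈τ = ∈-++⁺ˡ u∈τ
  from : τ ++ [ v ] ⊆ σ
  from p with ∈-++⁻ τ p
  ... | inj₁ u∈τ = ⊆σ (there u∈τ)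
  ... | inj₂ (here u≡v) = ⊆σ (here u≡v)

cone-apex : ∀ {Γ v τ} → Γ τ → cone Γ v (v ∷ τ)
cone-apex {τ = τ} Γτ = cone-intro τ Γτ id id

rank-void : ∀ {p} → Rank≤ p void
rank-void ()

rank-union : ∀ {p Γ Γ'} → Rank≤ p Γ → Rank≤ p Γ' → Rank≤ p (union Γ Γ')
rank-union r r' (inj₁ Γσ) = r Γσ
rank-union r r' (inj₂ Γ'σ) = r' Γ'σ

rank-minus : ∀ {p Δ Γ} → Rank≤ p Δ → Rank≤ p (minus Δ Γ)
rank-minus r (F , (ΔF , _) , _ , σ⊆F) uU U⊆σ = r ΔF uU (σ⊆F ∘ U⊆σ)

rank-cone : ∀ {p Γ v} → Rank≤ p Γ → Rank≤ (suc p) (cone Γ v)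
rank-cone {p} {v = v} r {U = U} C uU U⊆σ with cone-elim C
... | τ , Γτ , base with v ∈? U
...   | yes v∈U = subst (_≤ suc p) (sym (length-delete uU v∈U))
                    (s≤s (r Γτ (Unique-delete uU) λ q → let u∈U , u≢v = ∈-delete⁻ U q in base (U⊆σ u∈U) u≢v))
...   | no v∉U = ℕₚ.m≤n⇒m≤1+n (r Γτ uU λ q → base (U⊆σ q) λ { refl → v∉U q })

SubsetOfSize : ℕ → Face → Face → Set
SubsetOfSize p U σ = Unique U × U ⊆ σ × length U ≡ p

cone-full : ∀ {p Γ v σ U} → Rank≤ p Γ → cone Γ v σ → SubsetOfSize (suc p) U σ →
            v ∈ U × ∃[ τ ] Γ τ × SubsetOfSize p (delete v U) τ
cone-full {p} {v = v} {U = U} r C (uU , U⊆σ , |U|) with cone-elim C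
... | τ , Γτ , base with v ∈? U
...   | yes v∈U = v∈U , τ , Γτ , Unique-delete uU ,
          (λ q → let u∈U , u≢v = ∈-delete⁻ U q in base (U⊆σ u∈U) u≢v) ,
          ℕₚ.suc-injective (trans (sym (length-delete uU v∈U)) |U|)
...   | no v∉U = ⊥-elim (ℕₚ.<-irrefl refl
          (subst (_≤ p) |U| (r Γτ uU λ q → base (U⊆σ q) λ { refl → v∉U q })))

closed-cone : ∀ {Γ v} → DownClosed Γ → DownClosed (cone Γ v)
closed-cone {v = v} closed {σ} {ρ} C ρ⊆σ with cone-elim C
... | τ , Γτ , base with v ∈? ρ
...   | yes v∈ρ = cone-intro (delete v ρ)
          (closed Γτ λ q → let u∈ρ , u≢v = ∈-delete⁻ ρ q in base (ρ⊆σ u∈ρ) u≢v) ρ⊆ ⊆ρ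
  where
  ρ⊆ : ρ ⊆ v ∷ delete v ρ
  ρ⊆ {u} u∈ρ with u ℤ.≟ v
  ... | yes u≡v = here u≡v
  ... | no u≢v = there (∈-delete⁺ u∈ρ u≢v)
  ⊆ρ : v ∷ delete v ρ ⊆ ρ
  ⊆ρ (here refl) = v∈ρ
  ⊆ρ (there q) = proj₁ (∈-delete⁻ ρ q)
...   | no v∉ρ = ρ , [] , closed Γτ (λ q → base (ρ⊆σ q) λ { refl → v∉ρ q }) , here (λ ()) , ∈-++⁺ˡ , ρ++[]⊆ρ
  where
  ρ++[]⊆ρ : ρ ++ [] ⊆ ρ
  ρ++[]⊆ρ q with ∈-++⁻ ρ q
  ... | inj₁ u∈ρ = u∈ρ

closed-bdry : ∀ {B} → DownClosed (bdry B)
closed-bdry (F , x , τ , facet , x∈F , x∉τ , τ⊆F , F⊆ , unique , σ⊆τ) ρ⊆σ =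
  F , x , τ , facet , x∈F , x∉τ , τ⊆F , F⊆ , unique , σ⊆τ ∘ ρ⊆σ

negF : Face → Face
negF = map -_

negF-involutive : ∀ σ → negF (negF σ) ≡ σ
negF-involutive σ = trans (sym (map-∘ σ)) (trans (map-cong ℤₚ.neg-involutive σ) (map-id σ))

negF-mono : ∀ {σ τ} → σ ⊆ τ → negF σ ⊆ negF τ
negF-mono = ⊆ₚ.map⁺ -_

∈-negF⁺ : ∀ {x σ} → x ∈ σ → - x ∈ negF σ
∈-negF⁺ = ∈-map⁺ -_

∈-negF⁻ : ∀ {x σ} → - x ∈ negF σ → x ∈ σ
∈-negF⁻ p with ∈-map⁻ -_ p
... | y , y∈ , -x≡-y = subst (_∈ _) (sym (ℤₚ.neg-injective -x≡-y)) y∈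

Unique-negF : ∀ {σ} → Unique σ → Unique (negF σ)
Unique-negF = Uniqueₚ.map⁺ ℤₚ.neg-injective

length-negF : ∀ σ → length (negF σ) ≡ length σ
length-negF = length-map -_

negF-⊆⇒⊆-negF : ∀ {σ τ} → negF σ ⊆ τ → σ ⊆ negF τ
negF-⊆⇒⊆-negF {τ = τ} s {x} x∈ = subst (_∈ negF τ) (ℤₚ.neg-involutive x) (∈-negF⁺ (s (∈-negF⁺ x∈)))

⊆-negF⇒negF-⊆ : ∀ {σ τ} → σ ⊆ negF τ → negF σ ⊆ τ
⊆-negF⇒negF-⊆ {τ = τ} s p with ∈-map⁻ -_ p
... | x , x∈ , refl = subst (λ ρ → - x ∈ ρ) (negF-involutive τ) (∈-negF⁺ (s x∈))

rank-neg : ∀ {p Γ} → Rank≤ p Γ → Rank≤ p (neg Γ)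
rank-neg {p} r {U = U} Γσ uU U⊆σ = subst (_≤ p) (length-negF U) (r Γσ (Unique-negF uU) (negF-mono U⊆σ))

rank-bdry : ∀ {p B} → Rank≤ (suc p) B → Rank≤ p (bdry B)
rank-bdry r (F , x , τ , (BF , _) , x∈F , x∉τ , τ⊆F , _ , _ , σ⊆τ) uU U⊆σ =
  ℕₚ.≤-pred (r BF (Unique-∷ (λ q → x∉τ (σ⊆τ (U⊆σ q))) uU)
    λ { (here refl) → x∈F ; (there q) → τ⊆F (σ⊆τ (U⊆σ q)) })

rank-gen : ∀ {p Fs} → All (λ F → length F ≤ p) Fs → Rank≤ p (gen Fs)
rank-gen (|F| ∷ _) (here σ⊆F) uU U⊆σ = ℕₚ.≤-trans (Unique⇒length-mono uU (σ⊆F ∘ U⊆σ)) |F|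
rank-gen (_ ∷ |Fs|) (there σ∈) uU U⊆σ = rank-gen |Fs| σ∈ uU U⊆σ

∣i∣≡∣j∣⇒i≡j⊎i≡-j : ∀ i j → ∣ i ∣ ≡ ∣ j ∣ → i ≡ j ⊎ i ≡ - j
∣i∣≡∣j∣⇒i≡j⊎i≡-j (+ m) (+ n) refl = inj₁ refl
∣i∣≡∣j∣⇒i≡j⊎i≡-j (+ m) ℤ.-[1+ n ] refl = inj₂ refl
∣i∣≡∣j∣⇒i≡j⊎i≡-j ℤ.-[1+ m ] (+ n) refl = inj₂ refl
∣i∣≡∣j∣⇒i≡j⊎i≡-j ℤ.-[1+ m ] ℤ.-[1+ n ] refl = inj₁ refl

Unique-map-∣∣ : ∀ {σ} U → Unique U → U ⊆ σ → (∀ v → v ∈ σ → - v ∉ σ) → Unique (map ∣_∣ U)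
Unique-map-∣∣ [] _ _ _ = []
Unique-map-∣∣ (u ∷ U) (u∉U ∷ uU) U⊆σ antipodal =
  All.tabulate distinct ∷ Unique-map-∣∣ U uU (U⊆σ ∘ there) antipodal
  where
  distinct : ∀ {y} → y ∈ map ∣_∣ U → ∣ u ∣ ≢ y
  distinct p ∣u∣≡∣w∣ with ∈-map⁻ ∣_∣ p
  ... | w , w∈U , refl with ∣i∣≡∣j∣⇒i≡j⊎i≡-j u w ∣u∣≡∣w∣
  ...   | inj₁ refl = All.lookup u∉U w∈U refl
  ...   | inj₂ refl = antipodal w (U⊆σ (there w∈U)) (U⊆σ (here refl))

rank-crossBdry : ∀ {m} → Rank≤ m (crossBdry m)
rank-crossBdry {m} {U = U} (bounded , antipodal) uU U⊆σ =
  subst₂ _≤_ (length-map ∣_∣ U) (length-applyUpTo suc m)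
    (FiniteSets.Unique⇒length-mono ℕₚ._≟_ (Unique-map-∣∣ U uU U⊆σ antipodal) ∣U∣⊆)
  where
  ∈-range : ∀ {x} → 1 ≤ x → x ≤ m → x ∈ applyUpTo suc m
  ∈-range {suc x} _ x<m = ∈-applyUpTo⁺ suc x<m
  ∣U∣⊆ : map ∣_∣ U ⊆ applyUpTo suc m
  ∣U∣⊆ p with ∈-map⁻ ∣_∣ p
  ... | w , w∈U , refl = let 1≤ , ≤m = bounded w (U⊆σ w∈U) in ∈-range 1≤ ≤m

rank-ΔIt : ∀ d Bd → (∀ m → Rank≤ (suc d) (Bd m)) → ∀ t → Rank≤ (suc d) (ΔIt d Bd t)
rank-ΔIt d Bd rB zero = rank-crossBdry
rank-ΔIt d Bd rB (suc t) =
  rank-union (rank-minus (rank-ΔIt d Bd rB t))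
    (rank-union (rank-cone (rank-bdry (rB _))) (rank-cone (rank-bdry (rank-neg (rB _)))))

rank-Δgen : ∀ d Bd → (∀ m → Rank≤ (suc d) (Bd m)) → ∀ n → Rank≤ (suc d) (Δgen d Bd n)
rank-Δgen d Bd rB n with suc d ≤ᵇ n
... | true = rank-ΔIt d Bd rB (n ∸ suc d)
... | false = rank-void

cycEdges-length : ∀ n → All (λ e → length e ≤ 2) (cycEdges n)
cycEdges-length n = ℕₚ.≤-refl ∷ ℕₚ.≤-refl ∷ blocks (upTo (n ∸ 1))
  where
  blocks : ∀ js → All (λ e → length e ≤ 2) (concat (map (λ j → (+ suc j ∷ + suc (suc j) ∷ [])
                    ∷ (- (+ suc j) ∷ - (+ suc (suc j)) ∷ []) ∷ []) js))
  blocks [] = []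
  blocks (j ∷ js) = ℕₚ.≤-refl ∷ ℕₚ.≤-refl ∷ blocks js

rank-Brule : ∀ e → (∀ i m → Rank≤ (suc (suc e)) (Bfam (suc e) i m)) →
             ∀ i m → Rank≤ (suc (suc (suc e))) (Brule (Bfam (suc e)) i m)
rank-Brule e rB zero m = rank-union (rank-cone (rB zero _)) (rank-cone (rank-neg rank-void))
rank-Brule e rB (suc i) m = rank-union (rank-cone (rB (suc i) _)) (rank-cone (rank-neg (rB i _)))

rank-Bfam-suc : ∀ e → (∀ i m → Rank≤ (suc (suc e)) (Bfam (suc e) i m)) →
                ∀ i m → Rank≤ (suc (suc (suc e))) (Bfam (suc (suc e)) i m)
rank-Bfam-suc e rB i m with i ≤ᵇ ⌊ suc (suc e) /2⌋
... | true = rank-Brule e rB i m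
... | false with i ≡ᵇ ⌈ suc (suc e) /2⌉
...   | true = rank-minus (rank-Δgen (suc (suc e)) _ (rank-Brule e rB _) m)
...   | false = rank-void

rank-Bfam : ∀ d i m → Rank≤ (suc d) (Bfam d i m)
rank-Bfam zero i m = rank-void
rank-Bfam (suc zero) zero m = rank-gen (ℕₚ.≤-refl ∷ [])
rank-Bfam (suc zero) (suc zero) m = rank-minus (rank-gen (cycEdges-length m))
rank-Bfam (suc zero) (suc (suc i)) m = rank-void
rank-Bfam (suc (suc e)) = rank-Bfam-suc e (rank-Bfam (suc e))

closed-ΔIt : ∀ d Bd t → DownClosed (ΔIt d Bd t)
closed-ΔIt d Bd zero (bounded , antipodal) ρ⊆σ =
  (λ v p → bounded v (ρ⊆σ p)) , (λ v p q → antipodal v (ρ⊆σ p) (ρ⊆σ q))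
closed-ΔIt d Bd (suc t) (inj₁ (F , facet , F∉B , σ⊆F)) ρ⊆σ = inj₁ (F , facet , F∉B , σ⊆F ∘ ρ⊆σ)
closed-ΔIt d Bd (suc t) (inj₂ (inj₁ C)) ρ⊆σ = inj₂ (inj₁ (closed-cone closed-bdry C ρ⊆σ))
closed-ΔIt d Bd (suc t) (inj₂ (inj₂ C)) ρ⊆σ = inj₂ (inj₂ (closed-cone closed-bdry C ρ⊆σ))

closed-Δgen : ∀ d Bd n → DownClosed (Δgen d Bd n)
closed-Δgen d Bd n with suc d ≤ᵇ n
... | true = closed-ΔIt d Bd (n ∸ suc d)
... | false = λ ()

_≐_ : Cx → Cx → Set₁
Γ ≐ Γ' = ∀ σ → Γ σ ≡ Γ' σ

facet-≐ : ∀ {Γ Γ'} → Γ ≐ Γ' → ∀ {F} → Facet Γ' F → Facet Γ F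
facet-≐ Γ≐Γ' (Γ'F , maximal) =
  subst id (sym (Γ≐Γ' _)) Γ'F , λ G ΓG F⊆G → maximal G (subst id (Γ≐Γ' G) ΓG) F⊆G

bdry-≐ : ∀ {Γ Γ'} → Γ ≐ Γ' → ∀ {σ} → bdry Γ' σ → bdry Γ σ
bdry-≐ Γ≐Γ' (F , x , τ , facet , x∈F , x∉τ , τ⊆F , F⊆ , unique , σ⊆τ) =
  F , x , τ , facet-≐ Γ≐Γ' facet , x∈F , x∉τ , τ⊆F , F⊆ ,
  (λ G fG τ⊆G → unique G (facet-≐ (λ σ → sym (Γ≐Γ' σ)) fG) τ⊆G) , σ⊆τ

facet-neg : ∀ {B F} → Facet B F → Facet (neg B) (negF F)
facet-neg {B} {F} (BF , maximal) = subst B (sym (negF-involutive F)) BF ,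
  λ G BG sub → negF-⊆⇒⊆-negF (maximal (negF G) BG (negF-⊆⇒⊆-negF sub))

facet-neg⁻ : ∀ {B G} → Facet (neg B) G → Facet B (negF G)
facet-neg⁻ {B} (BG , maximal) = BG ,
  λ H BH sub → negF-⊆⇒⊆-negF (maximal (negF H) (subst B (sym (negF-involutive H)) BH) (negF-⊆⇒⊆-negF sub))

bdry-neg : ∀ {B σ} → bdry B σ → bdry (neg B) (negF σ)
bdry-neg {B} (F , x , τ , facet , x∈F , x∉τ , τ⊆F , F⊆ , unique , σ⊆τ) =
  negF F , - x , negF τ , facet-neg facet , ∈-negF⁺ x∈F , (λ p → x∉τ (∈-negF⁻ p)) ,
  negF-mono τ⊆F , negF-mono F⊆ , unique⁻ , negF-mono σ⊆τ
  where
  unique⁻ : (G : Face) → Facet (neg B) G → negF τ ⊆ G → G ≋ negF F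
  unique⁻ G fG τ⊆G with unique (negF G) (facet-neg⁻ fG) (negF-⊆⇒⊆-negF τ⊆G)
  ... | G⊆F , F⊆G = negF-⊆⇒⊆-negF G⊆F , ⊆-negF⇒negF-⊆ F⊆G

double : ℕ → ℕ
double zero = zero
double (suc j) = suc (suc (double j))

⌊double/2⌋ : ∀ j → ⌊ double j /2⌋ ≡ j
⌊double/2⌋ zero = refl
⌊double/2⌋ (suc j) = cong suc (⌊double/2⌋ j)

⌊1+double/2⌋ : ∀ j → ⌊ suc (double j) /2⌋ ≡ j
⌊1+double/2⌋ zero = refl
⌊1+double/2⌋ (suc j) = cong suc (⌊1+double/2⌋ j)

2*≡double : ∀ k → 2 * k ≡ double k
2*≡double zero = refl
2*≡double (suc k) = cong suc (trans (ℕₚ.+-suc k (k + 0)) (cong suc (2*≡double k)))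

Bfam≐Brule : ∀ e i → i ≤ ⌊ suc (suc e) /2⌋ → ∀ m → Bfam (suc (suc e)) i m ≐ Brule (Bfam (suc e)) i m
Bfam≐Brule e i i≤ m σ with i ≤ᵇ ⌊ suc (suc e) /2⌋ | ℕₚ.≤⇒≤ᵇ i≤
... | true | _ = refl

Bfam-odd≐Brule : ∀ j i → i ≤ suc j → ∀ m → Bfam (suc (double (suc j))) i m ≐ Brule (Bfam (double (suc j))) i m
Bfam-odd≐Brule j i i≤ = Bfam≐Brule (suc (double j)) i (subst (i ≤_) (sym (⌊1+double/2⌋ (suc j))) i≤)

Bfam-even≐Brule : ∀ j i → i ≤ suc j → ∀ m → Bfam (double (suc j)) i m ≐ Brule (Bfam (suc (double j))) i m
Bfam-even≐Brule j i i≤ = Bfam≐Brule (double j) i (subst (i ≤_) (sym (⌊double/2⌋ (suc j))) i≤)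

Bfam-odd-top : ∀ j m → Bfam (suc (double (suc j))) (suc (suc j)) m ≐
               minus (Δgen (suc (double (suc j))) (Brule (Bfam (double (suc j))) (suc j)) m)
                     (Brule (Bfam (double (suc j))) (suc j) m)
Bfam-odd-top j m σ rewrite ⌊1+double/2⌋ j | ⌊double/2⌋ j with suc (suc j) ≤ᵇ suc j in eq
... | true = ⊥-elim (ℕₚ.<-irrefl refl (ℕₚ.≤ᵇ⇒≤ (suc (suc j)) (suc j) (subst T (sym eq) tt)))
... | false with suc (suc j) ≡ᵇ suc (suc j) | ℕₚ.≡⇒≡ᵇ (suc (suc j)) (suc (suc j)) refl
...   | true | _ = refl

Δc-odd : ∀ j n → Δc (suc (2 * suc j)) n ≐ Δgen (suc (double (suc j))) (Bfam (suc (double (suc j))) (suc j)) n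
Δc-odd j n σ = trans (cong (λ d → Δc (suc d) n σ) (2*≡double (suc j))) unfold
  where
  unfold : Δc (suc (double (suc j))) n σ ≡ Δgen (suc (double (suc j))) (Bfam (suc (double (suc j))) (suc j)) n σ
  unfold rewrite ⌊double/2⌋ j = refl

HasAbs : ℕ → Face → Set
HasAbs m U = Any (λ w → ∣ w ∣ ≡ m) U

hasAbs : ∀ {v U m} → v ∈ U → ∣ v ∣ ≡ m → HasAbs m U
hasAbs v∈U ∣v∣≡m = Any.map (λ { refl → ∣v∣≡m }) v∈U

HasAbs-negF⁻ : ∀ {m} U → HasAbs m (negF U) → HasAbs m U
HasAbs-negF⁻ U h = Any.map (λ {u} ∣-u∣≡m → trans (sym (ℤₚ.∣-i∣≡∣i∣ u)) ∣-u∣≡m) (Anyₚ.map⁻ h)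

Brule-full-∋±m : ∀ e i m {σ U} → Brule (Bfam (suc e)) i m σ → SubsetOfSize (suc (suc (suc e))) U σ →
                 HasAbs m U
Brule-full-∋±m e i m (inj₁ C) U⊆σ = hasAbs (proj₁ (cone-full (rank-Bfam (suc e) i _) C U⊆σ)) refl
Brule-full-∋±m e zero m (inj₂ C) U⊆σ = hasAbs (proj₁ (cone-full (rank-neg rank-void) C U⊆σ)) (ℤₚ.∣-i∣≡∣i∣ (+ m))
Brule-full-∋±m e (suc i) m (inj₂ C) U⊆σ =
  hasAbs (proj₁ (cone-full (rank-neg (rank-Bfam (suc e) i _)) C U⊆σ)) (ℤₚ.∣-i∣≡∣i∣ (+ m))

Brule²-full-∋±m,±m∸1 : ∀ e i m {σ U} → i ≤ ⌊ suc (suc e) /2⌋ → Brule (Bfam (suc (suc e))) i m σ →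
                       SubsetOfSize (suc (suc (suc (suc e)))) U σ → HasAbs m U × HasAbs (m ∸ 1) U
Brule²-full-∋±m,±m∸1 e i m {U = U} i≤ (inj₁ C) U⊆σ
  with cone-full (rank-Bfam (suc (suc e)) i _) C U⊆σ
... | m∈U , τ , Bτ , U-m⊆τ =
  hasAbs m∈U refl ,
  ⊆ₚ.Any-resp-⊆ (proj₁ ∘ ∈-delete⁻ U)
    (Brule-full-∋±m e i (m ∸ 1) (subst id (Bfam≐Brule e i i≤ _ τ) Bτ) U-m⊆τ)
Brule²-full-∋±m,±m∸1 e zero m i≤ (inj₂ C) U⊆σ with cone-elim C
... | τ , () , _
Brule²-full-∋±m,±m∸1 e (suc i) m {U = U} i≤ (inj₂ C) U⊆σ
  with cone-full (rank-neg {Γ = Bfam (suc (suc e)) i (m ∸ 1)} (rank-Bfam (suc (suc e)) i _)) C U⊆σ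
... | -m∈U , τ , Bτ , (uU' , U'⊆τ , |U'|) =
  hasAbs -m∈U (ℤₚ.∣-i∣≡∣i∣ (+ m)) ,
  ⊆ₚ.Any-resp-⊆ (proj₁ ∘ ∈-delete⁻ U) (HasAbs-negF⁻ (delete (- (+ m)) U)
    (Brule-full-∋±m e i (m ∸ 1) (subst id (Bfam≐Brule e i (ℕₚ.≤-trans (ℕₚ.n≤1+n i) i≤) (m ∸ 1) (negF τ)) Bτ)
      (Unique-negF uU' , negF-mono U'⊆τ , trans (length-negF (delete (- (+ m)) U)) |U'|)))

ΔIt-keep : ∀ d Bd t {F} → (∀ m → Rank≤ (suc d) (Bd m)) → ΔIt d Bd t F → Unique F → length F ≡ suc d →
           ¬ Bd (suc d + t) F → ¬ Bd (suc d + t) (negF F) → ΔIt d Bd (suc t) F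
ΔIt-keep d Bd t rB ΔF uF |F| F∉B F∉-B =
  inj₁ (_ , (ΔF , λ G ΔG F⊆G → ⊆-maximal (suc d) (rank-ΔIt d Bd rB t ΔG) uF |F| F⊆G) ,
        (λ { (inj₁ B) → F∉B B ; (inj₂ -B) → F∉-B -B }) , id)

ΔIt-add⁺ : ∀ d Bd t {m τ} → suc d + t ≡ m → bdry (Bd m) τ → ΔIt d Bd (suc t) (+ suc m ∷ τ)
ΔIt-add⁺ d Bd t refl ∂τ = inj₂ (inj₁ (cone-apex ∂τ))

ΔIt-add⁻ : ∀ d Bd t {m τ} → suc d + t ≡ m → bdry (neg (Bd m)) τ → ΔIt d Bd (suc t) (- (+ suc m) ∷ τ)
ΔIt-add⁻ d Bd t refl ∂τ = inj₂ (inj₂ (cone-apex ∂τ))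

-- (e , a) encodes the pair of vertices {a+2, a} with sign e; a pair list is closed off by {2, 1} with sign e₀.
Pair : Set
Pair = Bool × ℕ

signed : Bool → ℤ → ℤ
signed true x = x
signed false x = - x

pairFace : Bool → List Pair → Face
pairFace e₀ [] = signed e₀ (+ 2) ∷ signed e₀ (+ 1) ∷ []
pairFace e₀ ((e , a) ∷ ps) = signed e (+ suc (suc a)) ∷ signed e (+ a) ∷ pairFace e₀ ps

lead : List Pair → ℕ
lead [] = 0
lead ((_ , a) ∷ _) = a

Spaced : List Pair → Set
Spaced [] = ⊤
Spaced ((_ , a) ∷ ps) = 3 + lead ps ≤ a × Spaced ps

flipSigns : List Pair → List Pair
flipSigns = map (λ { (e , a) → not e , a })

∣signed∣ : ∀ e x → ∣ signed e (+ x) ∣ ≡ x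
∣signed∣ true x = refl
∣signed∣ false x = ℤₚ.∣-i∣≡∣i∣ (+ x)

∣signed∣-≤ : ∀ e {x b} → x ≤ b → ∣ signed e (+ x) ∣ ≤ b
∣signed∣-≤ e {x} = subst (_≤ _) (sym (∣signed∣ e x))

-signed : ∀ e x → - signed (not e) x ≡ signed e x
-signed true x = ℤₚ.neg-involutive x
-signed false x = refl

pairFace-≤ : ∀ e₀ ps → Spaced ps → All (λ v → ∣ v ∣ ≤ 2 + lead ps) (pairFace e₀ ps)
pairFace-≤ e₀ [] _ = ∣signed∣-≤ e₀ ℕₚ.≤-refl ∷ ∣signed∣-≤ e₀ (s≤s z≤n) ∷ []
pairFace-≤ e₀ ((e , a) ∷ ps) (a-gap , spaced) =
  ∣signed∣-≤ e ℕₚ.≤-refl ∷ ∣signed∣-≤ e (ℕₚ.m≤n+m a 2) ∷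
  All.map (λ ≤lead → ℕₚ.≤-trans ≤lead (ℕₚ.≤-trans (ℕₚ.m≤n+m _ 1) (ℕₚ.≤-trans a-gap (ℕₚ.m≤n+m a 2))))
    (pairFace-≤ e₀ ps spaced)

pairFace-< : ∀ e₀ ps a → Spaced ps → 3 + lead ps ≤ a → ∀ {u} → u ∈ pairFace e₀ ps → ∣ u ∣ < a
pairFace-< e₀ ps a spaced a-gap u∈ = ℕₚ.<-≤-trans (s≤s (All.lookup (pairFace-≤ e₀ ps spaced) u∈)) a-gap

Decreasing : Face → Set
Decreasing = AllPairs (λ u v → ∣ v ∣ < ∣ u ∣)

Decreasing⇒Unique : ∀ {U} → Decreasing U → Unique U
Decreasing⇒Unique = AllPairs.map (λ { lt refl → ℕₚ.<-irrefl refl lt })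

pairFace-decreasing : ∀ e₀ ps → Spaced ps → Decreasing (pairFace e₀ ps)
pairFace-decreasing e₀ [] _ = (subst₂ _<_ (sym (∣signed∣ e₀ 1)) (sym (∣signed∣ e₀ 2)) ℕₚ.≤-refl ∷ []) ∷ [] ∷ []
pairFace-decreasing e₀ ((e , a) ∷ ps) (a-gap , spaced) =
  (subst₂ _<_ (sym (∣signed∣ e a)) (sym (∣signed∣ e (suc (suc a)))) (s≤s (ℕₚ.n≤1+n a)) ∷
   below (suc (suc a)) (ℕₚ.m≤n+m a 2)) ∷
  below a ℕₚ.≤-refl ∷
  pairFace-decreasing e₀ ps spaced
  where
  below : ∀ b → a ≤ b → All (λ u → ∣ u ∣ < ∣ signed e (+ b) ∣) (pairFace e₀ ps)
  below b a≤b = All.tabulate λ u∈ →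
    subst (λ z → _ < z) (sym (∣signed∣ e b)) (ℕₚ.<-≤-trans (pairFace-< e₀ ps a spaced a-gap u∈) a≤b)

length-pairFace : ∀ e₀ ps → length (pairFace e₀ ps) ≡ suc (suc (double (length ps)))
length-pairFace e₀ [] = refl
length-pairFace e₀ (_ ∷ ps) = cong (suc ∘ suc) (length-pairFace e₀ ps)

pairFace-full : ∀ e₀ ps {j} → length ps ≡ j → Spaced ps →
                SubsetOfSize (suc (suc (double j))) (pairFace e₀ ps) (pairFace e₀ ps)
pairFace-full e₀ ps refl spaced =
  Decreasing⇒Unique (pairFace-decreasing e₀ ps spaced) , id , length-pairFace e₀ ps

negF-pairFace : ∀ e₀ ps → negF (pairFace (not e₀) (flipSigns ps)) ≡ pairFace e₀ ps
negF-pairFace e₀ [] = cong₂ _∷_ (-signed e₀ _) (cong₂ _∷_ (-signed e₀ _) refl)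
negF-pairFace e₀ ((e , a) ∷ ps) = cong₂ _∷_ (-signed e _) (cong₂ _∷_ (-signed e _) (negF-pairFace e₀ ps))

lead-flipSigns : ∀ ps → lead (flipSigns ps) ≡ lead ps
lead-flipSigns [] = refl
lead-flipSigns (_ ∷ _) = refl

Spaced-flipSigns : ∀ ps → Spaced ps → Spaced (flipSigns ps)
Spaced-flipSigns [] _ = tt
Spaced-flipSigns ((e , a) ∷ ps) (a-gap , spaced) =
  subst (λ l → 3 + l ≤ a) (sym (lead-flipSigns ps)) a-gap , Spaced-flipSigns ps spaced

¬HasAbs-above : ∀ {b m U} → All (λ v → ∣ v ∣ ≤ b) U → b < m → ¬ HasAbs m U
¬HasAbs-above (∣u∣≤b ∷ _) b<m (here refl) = ℕₚ.<-irrefl refl (ℕₚ.<-≤-trans b<m ∣u∣≤b)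
¬HasAbs-above (_ ∷ bounds) b<m (there h) = ¬HasAbs-above bounds b<m h

-- The absolute values in this face are at most a+2 and skip a+1.
pairFace-¬HasAbs-m,m∸1 : ∀ e₀ e a ps → Spaced ((e , a) ∷ ps) → ∀ m → 2 + a ≤ m →
                         HasAbs m (pairFace e₀ ((e , a) ∷ ps)) → ¬ HasAbs (m ∸ 1) (pairFace e₀ ((e , a) ∷ ps))
pairFace-¬HasAbs-m,m∸1 e₀ e a ps spaced m a+2≤m hasM with ℕₚ.m≤n⇒m<n∨m≡n a+2≤m
... | inj₁ a+2<m = ⊥-elim (¬HasAbs-above (pairFace-≤ e₀ ((e , a) ∷ ps) spaced) a+2<m hasM)
... | inj₂ refl = ¬a+1
  where
  ¬a+1 : ¬ HasAbs (suc a) (pairFace e₀ ((e , a) ∷ ps))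
  ¬a+1 (here ∣a+2∣≡a+1) = ℕₚ.1+n≢n (trans (sym (∣signed∣ e _)) ∣a+2∣≡a+1)
  ¬a+1 (there (here ∣a∣≡a+1)) = ℕₚ.1+n≢n (sym (trans (sym (∣signed∣ e a)) ∣a∣≡a+1))
  ¬a+1 (there (there h)) = ¬HasAbs-above (pairFace-≤ e₀ ps (proj₂ spaced)) (ℕₚ.m≤n⇒m≤1+n (proj₁ spaced)) h

pairFace⊄Brule : ∀ j i e₀ ps → i ≤ suc j → length ps ≡ suc j → Spaced ps → ∀ m → 2 + lead ps ≤ m → ∀ {σ} →
                 Brule (Bfam (suc (suc (double j)))) i m σ → ¬ (pairFace e₀ ps ⊆ σ) × ¬ (negF (pairFace e₀ ps) ⊆ σ)
pairFace⊄Brule j i e₀ ((e , a) ∷ ps) i≤ |ps| spaced m a+2≤m {σ} Bσ = excluded , excluded⁻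
  where
  i≤half : i ≤ ⌊ suc (suc (double j)) /2⌋
  i≤half = subst (i ≤_) (sym (⌊double/2⌋ (suc j))) i≤
  F : Face
  F = pairFace e₀ ((e , a) ∷ ps)
  uF : Unique F
  uF = proj₁ (pairFace-full e₀ ((e , a) ∷ ps) |ps| spaced)
  |F| : length F ≡ suc (suc (double (suc j)))
  |F| = proj₂ (proj₂ (pairFace-full e₀ ((e , a) ∷ ps) |ps| spaced))
  excluded : ¬ (F ⊆ σ)
  excluded F⊆σ with Brule²-full-∋±m,±m∸1 (double j) i m i≤half Bσ (uF , F⊆σ , |F|)
  ... | hasM , hasM∸1 = pairFace-¬HasAbs-m,m∸1 e₀ e a ps spaced m a+2≤m hasM hasM∸1
  excluded⁻ : ¬ (negF F ⊆ σ)
  excluded⁻ -F⊆σ with Brule²-full-∋±m,±m∸1 (double j) i m i≤half Bσ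
                        (Unique-negF uF , -F⊆σ , trans (length-negF F) |F|)
  ... | hasM , hasM∸1 = pairFace-¬HasAbs-m,m∸1 e₀ e a ps spaced m a+2≤m (HasAbs-negF⁻ F hasM) (HasAbs-negF⁻ F hasM∸1)

B[2j+3,j+1] : ℕ → ℕ → Cx
B[2j+3,j+1] j = Brule (Bfam (double (suc j))) (suc j)

rank-B[2j+3,j+1] : ∀ j m → Rank≤ (suc (suc (double (suc j)))) (B[2j+3,j+1] j m)
rank-B[2j+3,j+1] j = rank-Brule (suc (double j)) (rank-Bfam (suc (suc (double j)))) (suc j)

∣∣<⇒≢ : ∀ {u v : ℤ} → ∣ u ∣ < ∣ v ∣ → u ≢ v
∣∣<⇒≢ lt refl = ℕₚ.<-irrefl refl lt

-+≢+ : ∀ {a} → 0 < a → - (+ a) ≢ + a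
-+≢+ {suc a} _ ()

a∷pairFace-decreasing : ∀ e₀ ps a → Spaced ps → 3 + lead ps ≤ a → Decreasing (+ a ∷ pairFace e₀ ps)
a∷pairFace-decreasing e₀ ps a spaced a-gap =
  All.tabulate (pairFace-< e₀ ps a spaced a-gap) ∷ pairFace-decreasing e₀ ps spaced

negF[a∷pairFace]⊄B[2j+2,j] : ∀ j e₀ ps → length ps ≡ j → Spaced ps → ∀ a → 3 + lead ps ≤ a → ∀ {ρ} →
                             Brule (Bfam (suc (double j))) j a ρ → ¬ (negF (+ a ∷ pairFace e₀ ps) ⊆ ρ)
negF[a∷pairFace]⊄B[2j+2,j] j e₀ ps |ps| spaced a a-gap (inj₁ C) -τ⊆ρ with cone-elim C
... | α , Bα , base = ℕₚ.<-irrefl refl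
        (subst (_≤ suc (suc (double j))) |-τ|
          (rank-Bfam (suc (double j)) j (a ∸ 1) Bα
            (Unique-negF (Decreasing⇒Unique (a∷pairFace-decreasing e₀ ps a spaced a-gap))) -τ⊆α))
  where
  |-τ| : length (negF (+ a ∷ pairFace e₀ ps)) ≡ suc (suc (suc (double j)))
  |-τ| = trans (length-negF (+ a ∷ pairFace e₀ ps)) (cong suc (trans (length-pairFace e₀ ps) (cong (suc ∘ suc ∘ double) |ps|)))
  -τ⊆α : negF (+ a ∷ pairFace e₀ ps) ⊆ α
  -τ⊆α (here refl) = base (-τ⊆ρ (here refl)) (-+≢+ (ℕₚ.<-≤-trans z<s a-gap))
  -τ⊆α (there q) with ∈-map⁻ -_ q
  ... | u , u∈ , refl = base (-τ⊆ρ (there q)) (∣∣<⇒≢ (subst (_< a) (sym (ℤₚ.∣-i∣≡∣i∣ u)) (pairFace-< e₀ ps a spaced a-gap u∈)))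
negF[a∷pairFace]⊄B[2j+2,j] zero e₀ ps |ps| spaced a a-gap (inj₂ C) _ with cone-elim C
... | _ , () , _
negF[a∷pairFace]⊄B[2j+2,j] (suc j) e₀ ps |ps| spaced a a-gap (inj₂ C) -τ⊆ρ with cone-elim C
... | α , Bα , base =
  proj₁ (pairFace⊄Brule j j e₀ ps (ℕₚ.n≤1+n j) |ps| spaced (a ∸ 1) (ℕₚ.∸-monoˡ-≤ 1 a-gap)
           (subst id (Bfam-odd≐Brule j j (ℕₚ.n≤1+n j) (a ∸ 1) _) Bα))
        (negF-⊆⇒⊆-negF -pairFace⊆α)
  where
  -pairFace⊆α : negF (pairFace e₀ ps) ⊆ α
  -pairFace⊆α q with ∈-map⁻ -_ q
  ... | u , u∈ , refl = base (-τ⊆ρ (there q))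
          (∣∣<⇒≢ (subst₂ _<_ (sym (ℤₚ.∣-i∣≡∣i∣ u)) (sym (ℤₚ.∣-i∣≡∣i∣ (+ a))) (pairFace-< e₀ ps a spaced a-gap u∈)))

B[2j+3,j+1]-∌-apex⁻ : ∀ j e₀ ps → length ps ≡ j → Spaced ps → ∀ a → 3 + lead ps ≤ a → ∀ {G} →
                      B[2j+3,j+1] j (suc a) G → - (+ suc a) ∈ G → + a ∷ pairFace e₀ ps ⊆ G → ⊥
B[2j+3,j+1]-∌-apex⁻ j e₀ ps refl spaced a a-gap (inj₁ C) -a-1∈G τ⊆G with cone-elim C
... | α , Bα , base = ℕₚ.<-irrefl refl
        (subst (_≤ suc (double (suc j))) (cong (suc ∘ suc) (length-pairFace e₀ ps))
          (rank-Bfam (double (suc j)) (suc j) a Bα (Decreasing⇒Unique W-decreasing) W⊆α))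
  where
  pairFace<a : ∀ {u} → u ∈ pairFace e₀ ps → ∣ u ∣ < a
  pairFace<a = pairFace-< e₀ ps a spaced a-gap
  W-decreasing : Decreasing (- (+ suc a) ∷ + a ∷ pairFace e₀ ps)
  W-decreasing = (ℕₚ.≤-refl ∷ All.tabulate (λ q → ℕₚ.<-trans (pairFace<a q) (ℕₚ.n<1+n a)))
                 ∷ a∷pairFace-decreasing e₀ ps a spaced a-gap
  W⊆α : - (+ suc a) ∷ + a ∷ pairFace e₀ ps ⊆ α
  W⊆α (here refl) = base -a-1∈G (λ ())
  W⊆α (there (here refl)) = base (τ⊆G (here refl)) (∣∣<⇒≢ (ℕₚ.n<1+n a))
  W⊆α (there (there q)) = base (τ⊆G (there q)) (∣∣<⇒≢ (ℕₚ.<-trans (pairFace<a q) (ℕₚ.n<1+n a)))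
B[2j+3,j+1]-∌-apex⁻ j e₀ ps |ps| spaced a a-gap (inj₂ C) -a-1∈G τ⊆G with cone-elim C
... | α , Bα , base = negF[a∷pairFace]⊄B[2j+2,j] j e₀ ps |ps| spaced a a-gap
                        (subst id (Bfam-even≐Brule j j (ℕₚ.n≤1+n j) a (negF α)) Bα) (negF-mono τ⊆α)
  where
  τ⊆α : + a ∷ pairFace e₀ ps ⊆ α
  τ⊆α (here refl) = base (τ⊆G (here refl)) (λ ())
  τ⊆α (there q) = base (τ⊆G (there q)) (∣∣<⇒≢ (ℕₚ.<-trans (pairFace-< e₀ ps a spaced a-gap q) (ℕₚ.n<1+n a)))

PairFacesInB : ℕ → Set
PairFacesInB j = ∀ e₀ ps → length ps ≡ j → Spaced ps → ∀ m → 2 + lead ps ≤ m →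
                 Bfam (suc (double j)) (suc j) m (pairFace e₀ ps)

a∷pairFace∈∂B : ∀ j → PairFacesInB j → ∀ e₀ ps → length ps ≡ j → Spaced ps → ∀ a → 3 + lead ps ≤ a →
                bdry (B[2j+3,j+1] j (suc a)) (+ a ∷ pairFace e₀ ps)
a∷pairFace∈∂B j inB e₀ ps |ps| spaced a a-gap =
  F , + suc a , τ , (BF , λ _ → maximal) , here refl , a+1∉τ , there , id , onlyFacet , id
  where
  τ F : Face
  τ = + a ∷ pairFace e₀ ps
  F = + suc a ∷ τ
  uτ : Unique τ
  uτ = Decreasing⇒Unique (a∷pairFace-decreasing e₀ ps a spaced a-gap)
  a+1∉τ : + suc a ∉ τ
  a+1∉τ (here eq) = ℕₚ.1+n≢n (ℤₚ.+-injective eq)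
  a+1∉τ (there q) = ℕₚ.<-asym (pairFace-< e₀ ps a spaced a-gap q) (ℕₚ.n<1+n a)
  |τ| : length τ ≡ suc (suc (suc (double j)))
  |τ| = cong suc (trans (length-pairFace e₀ ps) (cong (suc ∘ suc ∘ double) |ps|))
  Bτ : Bfam (double (suc j)) (suc j) a τ
  Bτ = subst id (sym (Bfam-even≐Brule j (suc j) ℕₚ.≤-refl a τ))
         (inj₁ (cone-apex (inB e₀ ps |ps| spaced (a ∸ 1) (ℕₚ.∸-monoˡ-≤ 1 a-gap))))
  BF : B[2j+3,j+1] j (suc a) F
  BF = inj₁ (cone-apex Bτ)
  maximal : ∀ {G} → B[2j+3,j+1] j (suc a) G → F ⊆ G → G ⊆ F
  maximal BG = ⊆-maximal _ (rank-B[2j+3,j+1] j (suc a) BG) (Unique-∷ a+1∉τ uτ) (cong suc |τ|)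
  onlyFacet : (G : Face) → Facet (B[2j+3,j+1] j (suc a)) G → τ ⊆ G → G ≋ F
  onlyFacet G (BG , G-maximal) τ⊆G with ⊆-or-∉ G τ
  ... | inj₁ G⊆τ = ⊥-elim (a+1∉τ (G⊆τ (G-maximal F BF (there ∘ G⊆τ) (here refl))))
  ... | inj₂ (y , y∈G , y∉τ) = extend (Brule-full-∋±m (suc (double j)) (suc j) (suc a) BG
                                         (Unique-∷ y∉τ uτ , y∷τ⊆G , cong suc |τ|))
    where
    y∷τ⊆G : y ∷ τ ⊆ G
    y∷τ⊆G (here refl) = y∈G
    y∷τ⊆G (there q) = τ⊆G q
    extend : HasAbs (suc a) (y ∷ τ) → G ≋ F
    extend (here ∣y∣≡a+1) with ∣i∣≡∣j∣⇒i≡j⊎i≡-j y (+ suc a) ∣y∣≡a+1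
    ... | inj₁ refl = maximal BG y∷τ⊆G , y∷τ⊆G
    ... | inj₂ refl = ⊥-elim (B[2j+3,j+1]-∌-apex⁻ j e₀ ps |ps| spaced a a-gap BG y∈G τ⊆G)
    extend (there (here a≡a+1)) = ⊥-elim (ℕₚ.1+n≢n (sym a≡a+1))
    extend (there (there h)) = ⊥-elim (¬HasAbs-above (pairFace-≤ e₀ ps spaced) (ℕₚ.m≤n⇒m≤1+n a-gap) h)

3*length≤lead : ∀ ps → Spaced ps → 3 * length ps ≤ lead ps
3*length≤lead [] _ = z≤n
3*length≤lead ((e , a) ∷ ps) (a-gap , spaced) =
  subst (_≤ a) (sym (ℕₚ.*-suc 3 (length ps))) (ℕₚ.≤-trans (ℕₚ.+-monoʳ-≤ 3 (3*length≤lead ps spaced)) a-gap)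


1+double≤3* : ∀ j → suc (double (suc j)) ≤ 3 * suc j
1+double≤3* zero = ℕₚ.≤-refl
1+double≤3* (suc j) = subst (suc (double (suc (suc j))) ≤_) (sym (ℕₚ.*-suc 3 (suc j)))
                        (s≤s (s≤s (ℕₚ.≤-trans (1+double≤3* j) (ℕₚ.m≤n+m _ 1))))

Δgen-persist : ∀ d Bd t₁ {F} → (∀ m → Rank≤ (suc d) (Bd m)) → Unique F → length F ≡ suc d → ΔIt d Bd t₁ F →
               (∀ m → suc d + t₁ ≤ m → ¬ Bd m F × ¬ Bd m (negF F)) → ∀ n → suc d + t₁ ≤ n → Δgen d Bd n F
Δgen-persist d Bd t₁ {F} rB uF |F| ΔF avoids n d+t₁≤n with suc d ≤ᵇ n | ℕₚ.≤⇒≤ᵇ (ℕₚ.m+n≤o⇒m≤o (suc d) d+t₁≤n)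
... | true | _ = subst (λ t → ΔIt d Bd t F) (ℕₚ.m∸n+n≡m t₁≤n∸d) (stays (n ∸ suc d ∸ t₁))
  where
  t₁≤n∸d : t₁ ≤ n ∸ suc d
  t₁≤n∸d = ℕₚ.m+n≤o⇒m≤o∸n t₁ (subst (_≤ n) (ℕₚ.+-comm (suc d) t₁) d+t₁≤n)
  stays : ∀ s → ΔIt d Bd (s + t₁) F
  stays zero = ΔF
  stays (suc s) = ΔIt-keep d Bd (s + t₁) rB (stays s) uF |F| (proj₁ later) (proj₂ later)
    where
    later : ¬ Bd (suc d + (s + t₁)) F × ¬ Bd (suc d + (s + t₁)) (negF F)
    later = avoids _ (ℕₚ.+-monoʳ-≤ (suc d) (ℕₚ.m≤n+m t₁ s))

-- A pair face with lead pair (e , a) enters Δ at vertex a+2, as a cone over a boundary face of ±B_{a+1},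
-- and persists because it misses the pair of absolute values m, m-1 met by facets of later balls B_m.
pairFace∈Δgen : ∀ j → PairFacesInB j → ∀ Bd → (∀ m → Bd m ≐ B[2j+3,j+1] j m) →
                ∀ e₀ ps → length ps ≡ suc j → Spaced ps → ∀ n → 2 + lead ps ≤ n →
                Δgen (suc (double (suc j))) Bd n (pairFace e₀ ps)
pairFace∈Δgen j inB Bd Bd≐B e₀ ((e , a) ∷ ps) |ps| (a-gap , spaced) n a+2≤n =
  Δgen-persist D Bd (suc t₀) rB uF (proj₂ (proj₂ F-full)) (enters e) avoids n (subst (_≤ n) (sym a+2≡) a+2≤n)
  where
  D : ℕ
  D = suc (double (suc j))
  F-full : SubsetOfSize (suc D) (pairFace e₀ ((e , a) ∷ ps)) (pairFace e₀ ((e , a) ∷ ps))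
  F-full = pairFace-full e₀ ((e , a) ∷ ps) |ps| (a-gap , spaced)
  uF : Unique (pairFace e₀ ((e , a) ∷ ps))
  uF = proj₁ F-full
  |ps|' : length ps ≡ j
  |ps|' = ℕₚ.suc-injective |ps|
  D≤a : D ≤ a
  D≤a = ℕₚ.≤-trans (1+double≤3* j) (subst (λ l → 3 * l ≤ a) |ps| (3*length≤lead ((e , a) ∷ ps) (a-gap , spaced)))
  t₀ : ℕ
  t₀ = a ∸ D
  D+t₀≡a : D + t₀ ≡ a
  D+t₀≡a = ℕₚ.m+[n∸m]≡n D≤a
  rB : ∀ m → Rank≤ (suc D) (Bd m)
  rB m {σ} Bσ = rank-B[2j+3,j+1] j m (subst id (Bd≐B m σ) Bσ)
  enters : ∀ e' → ΔIt D Bd (suc t₀) (pairFace e₀ ((e' , a) ∷ ps))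
  enters true = ΔIt-add⁺ D Bd t₀ (cong suc D+t₀≡a)
    (bdry-≐ (Bd≐B (suc a)) (a∷pairFace∈∂B j inB e₀ ps |ps|' spaced a a-gap))
  enters false = ΔIt-add⁻ D Bd t₀ (cong suc D+t₀≡a)
    (bdry-≐ (λ σ → Bd≐B (suc a) (negF σ))
      (subst (λ ρ → bdry (neg (B[2j+3,j+1] j (suc a))) (- (+ a) ∷ ρ)) (negF-pairFace e₀ ps)
        (bdry-neg (a∷pairFace∈∂B j inB (not e₀) (flipSigns ps) (trans (length-map _ ps) |ps|')
          (Spaced-flipSigns ps spaced) a (subst (λ l → 3 + l ≤ a) (sym (lead-flipSigns ps)) a-gap)))))
  a+2≡ : suc D + suc t₀ ≡ 2 + a
  a+2≡ = cong suc (trans (ℕₚ.+-suc D t₀) (cong suc D+t₀≡a))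
  avoids : ∀ m → suc D + suc t₀ ≤ m →
           ¬ Bd m (pairFace e₀ ((e , a) ∷ ps)) × ¬ Bd m (negF (pairFace e₀ ((e , a) ∷ ps)))
  avoids m ≤m = (λ B → proj₁ (excluded B) id) , (λ B → proj₂ (excluded B) id)
    where
    excluded : ∀ {σ} → Bd m σ → ¬ (pairFace e₀ ((e , a) ∷ ps) ⊆ σ) × ¬ (negF (pairFace e₀ ((e , a) ∷ ps)) ⊆ σ)
    excluded {σ} B = pairFace⊄Brule j (suc j) e₀ ((e , a) ∷ ps) ℕₚ.≤-refl |ps| (a-gap , spaced) m
                       (subst (_≤ m) a+2≡ ≤m) (subst id (Bd≐B m σ) B)

pairFacesInB-suc : ∀ j → PairFacesInB j → PairFacesInB (suc j)
pairFacesInB-suc j inB e₀ ps |ps| spaced m lead+2≤m =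
  subst id (sym (Bfam-odd-top j m F)) (F , (ΔF , maximal) , F∉B , id)
  where
  F : Face
  F = pairFace e₀ ps
  ΔF : Δgen (suc (double (suc j))) (B[2j+3,j+1] j) m F
  ΔF = pairFace∈Δgen j inB (B[2j+3,j+1] j) (λ _ _ → refl) e₀ ps |ps| spaced m lead+2≤m
  maximal : (G : Face) → Δgen (suc (double (suc j))) (B[2j+3,j+1] j) m G → F ⊆ G → G ⊆ F
  maximal G ΔG = let uF , _ , |F| = pairFace-full e₀ ps |ps| spaced in
    ⊆-maximal _ (rank-Δgen (suc (double (suc j))) (B[2j+3,j+1] j) (rank-B[2j+3,j+1] j) m ΔG) uF |F|
  F∉B : ¬ B[2j+3,j+1] j m F
  F∉B B = proj₁ (pairFace⊄Brule j (suc j) e₀ ps ℕₚ.≤-refl |ps| spaced m lead+2≤m B) id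

pairFacesInB-zero : PairFacesInB 0
pairFacesInB-zero e₀ [] _ _ (suc zero) (s≤s ())
pairFacesInB-zero e₀ [] _ _ (suc (suc m)) _ =
  pairFace e₀ [] , (edge e₀ , maximal) , ¬⊆[-1,m] e₀ , id
  where
  edge : ∀ e₀ → cycle (suc (suc m)) (pairFace e₀ [])
  edge true = there (there (here λ { (here refl) → there (here refl) ; (there (here refl)) → here refl }))
  edge false = there (there (there (here λ { (here refl) → there (here refl) ; (there (here refl)) → here refl })))
  maximal : (G : Face) → cycle (suc (suc m)) G → pairFace e₀ [] ⊆ G → G ⊆ pairFace e₀ []
  maximal G CG = ⊆-maximal 2 (rank-gen (cycEdges-length (suc (suc m))) CG)
                   (Decreasing⇒Unique (pairFace-decreasing e₀ [] tt)) refl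
  ¬⊆[-1,m] : ∀ e₀ → ¬ simplex (- (+ 1) ∷ + suc (suc m) ∷ []) (pairFace e₀ [])
  ¬⊆[-1,m] true (here ⊆[-1,m]) with ⊆[-1,m] (there (here refl))
  ... | here ()
  ... | there (here ())
  ¬⊆[-1,m] false (here ⊆[-1,m]) with ⊆[-1,m] (here refl)
  ... | here ()
  ... | there (here ())

pairFacesInB : ∀ j → PairFacesInB j
pairFacesInB zero = pairFacesInB-zero
pairFacesInB (suc j) = pairFacesInB-suc j (pairFacesInB j)

⊆pairFace⇒∈Δ : ∀ j e₀ ps → length ps ≡ suc j → Spaced ps → ∀ n → 2 + lead ps ≤ n → ∀ {ρ} →
               ρ ⊆ pairFace e₀ ps → Δc (suc (2 * suc j)) n ρ
⊆pairFace⇒∈Δ j e₀ ps |ps| spaced n lead+2≤n {ρ} ρ⊆F = subst id (sym (Δc-odd j n ρ))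
  (closed-Δgen (suc (double (suc j))) _ n
    (pairFace∈Δgen j (pairFacesInB j) (Bfam (suc (double (suc j))) (suc j))
      (Bfam-odd≐Brule j (suc j) ℕₚ.≤-refl) e₀ ps |ps| spaced n lead+2≤n) ρ⊆F)

leadℕ : List ℕ → ℕ
leadℕ [] = 0
leadℕ (a ∷ _) = a

Sparse : List ℕ → Set
Sparse [] = ⊤
Sparse (a ∷ as) = 7 + leadℕ as ≤ a × Sparse as

pairVertices : List ℕ → Face
pairVertices [] = []
pairVertices (a ∷ as) = + suc (suc a) ∷ + a ∷ pairVertices as

positive : List ℕ → List Pair
positive = map (true ,_)

lead-positive : ∀ as → lead (positive as) ≡ leadℕ as
lead-positive [] = refl
lead-positive (_ ∷ _) = refl

Sparse⇒Spaced : ∀ as → Sparse as → Spaced (positive as)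
Sparse⇒Spaced [] _ = tt
Sparse⇒Spaced (a ∷ as) (a-gap , sparse) =
  subst (λ l → 3 + l ≤ a) (sym (lead-positive as)) (ℕₚ.≤-trans (ℕₚ.+-monoˡ-≤ (leadℕ as) (ℕₚ.m≤n+m 3 4)) a-gap) ,
  Sparse⇒Spaced as sparse

pairVertices⊆pairFace : ∀ as → pairVertices as ⊆ pairFace true (positive as)
pairVertices⊆pairFace (a ∷ as) (here refl) = here refl
pairVertices⊆pairFace (a ∷ as) (there (here refl)) = there (here refl)
pairVertices⊆pairFace (a ∷ as) (there (there q)) = there (there (pairVertices⊆pairFace as q))

[1,2]⊆pairFace : ∀ ps → + 1 ∷ + 2 ∷ [] ⊆ pairFace true ps
[1,2]⊆pairFace [] (here refl) = there (here refl)
[1,2]⊆pairFace [] (there (here refl)) = here refl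
[1,2]⊆pairFace (_ ∷ ps) q = there (there ([1,2]⊆pairFace ps q))

pairVertices-≤ : ∀ as → Sparse as → All (λ u → ∣ u ∣ ≤ 2 + leadℕ as) (pairVertices as)
pairVertices-≤ as sparse = All.tabulate λ q →
  subst (λ l → _ ≤ 2 + l) (lead-positive as)
    (All.lookup (pairFace-≤ true (positive as) (Sparse⇒Spaced as sparse)) (pairVertices⊆pairFace as q))

pairVertices-≥3 : ∀ as → Sparse as → All (λ u → 3 ≤ ∣ u ∣) (pairVertices as)
pairVertices-≥3 [] _ = []
pairVertices-≥3 (a ∷ as) (a-gap , sparse) = ℕₚ.≤-trans 3≤a (ℕₚ.m≤n+m a 2) ∷ 3≤a ∷ pairVertices-≥3 as sparse
  where
  3≤a : 3 ≤ a
  3≤a = ℕₚ.≤-trans (ℕₚ.m≤m+n 3 (4 + leadℕ as)) a-gap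

pairVertices-decreasing : ∀ as → Sparse as → Decreasing (pairVertices as)
pairVertices-decreasing [] _ = []
pairVertices-decreasing (a ∷ as) (a-gap , sparse) =
  (s≤s (ℕₚ.n≤1+n a) ∷ below (ℕₚ.m≤n+m a 2)) ∷ below ℕₚ.≤-refl ∷ pairVertices-decreasing as sparse
  where
  below : ∀ {b} → a ≤ b → All (λ u → ∣ u ∣ < b) (pairVertices as)
  below a≤b = All.map (λ ≤lead → ℕₚ.≤-trans (s≤s ≤lead)
                (ℕₚ.≤-trans (ℕₚ.≤-trans (ℕₚ.+-monoˡ-≤ (leadℕ as) (ℕₚ.m≤n+m 3 4)) a-gap) a≤b))
                (pairVertices-≤ as sparse)

length-pairVertices : ∀ as → length (pairVertices as) ≡ double (length as)
length-pairVertices [] = refl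
length-pairVertices (_ ∷ as) = cong (suc ∘ suc) (length-pairVertices as)

interval : ℕ → ℕ → List ℕ
interval lo hi = applyDownFrom (λ i → lo + i) (suc hi ∸ lo)

∈-interval⁻ : ∀ lo hi {w} → w ∈ interval lo hi → lo ≤ w × w ≤ hi
∈-interval⁻ lo hi q with ∈-applyDownFrom⁻ (λ i → lo + i) q
... | i , i<count , refl = ℕₚ.m≤m+n lo i , ℕₚ.≤-pred (subst (_≤ suc hi) (cong suc (ℕₚ.+-comm i lo))
                                              (ℕₚ.m≤o∸n⇒m+n≤o (suc i) lo≤1+hi i<count))
  where
  lo≤1+hi : lo ≤ suc hi
  lo≤1+hi = ℕₚ.<⇒≤ (ℕₚ.m∸n≢0⇒n<m λ count≡0 → ℕₚ.n≮0 (subst (i <_) count≡0 i<count))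

Unique-interval : ∀ lo hi → Unique (interval lo hi)
Unique-interval lo hi = Uniqueₚ.applyDownFrom⁺₁ (λ i → lo + i) _
  λ j<i _ lo+i≡lo+j → ℕₚ.<-irrefl (sym (ℕₚ.+-cancelˡ-≡ lo _ _ lo+i≡lo+j)) j<i

-- The integers in [3, hi] other than a, a+1, a+2 for the starts a of as.
freeVertices : List ℕ → ℕ → List ℕ
freeVertices [] hi = interval 3 hi
freeVertices (a ∷ as) hi = interval (3 + a) hi ++ freeVertices as (a ∸ 1)

Sparse-tail : ∀ a as → 7 + leadℕ as ≤ a → leadℕ as ≤ a ∸ 1
Sparse-tail a as a-gap = ℕₚ.≤-trans (ℕₚ.m≤n+m _ 6) (ℕₚ.∸-monoˡ-≤ 1 a-gap)

∈-freeVertices⁻ : ∀ as hi → Sparse as → leadℕ as ≤ hi → ∀ {w} → w ∈ freeVertices as hi → 3 ≤ w × w ≤ hi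
∈-freeVertices⁻ [] hi _ _ q = ∈-interval⁻ 3 hi q
∈-freeVertices⁻ (a ∷ as) hi (a-gap , sparse) a≤hi q with ∈-++⁻ (interval (3 + a) hi) q
... | inj₁ q' = let 3+a≤w , w≤hi = ∈-interval⁻ (3 + a) hi q' in ℕₚ.≤-trans (ℕₚ.m≤m+n 3 a) 3+a≤w , w≤hi
... | inj₂ q' = let 3≤w , w≤a-1 = ∈-freeVertices⁻ as (a ∸ 1) sparse (Sparse-tail a as a-gap) q' in
                3≤w , ℕₚ.≤-trans w≤a-1 (ℕₚ.≤-trans (ℕₚ.m∸n≤m a 1) a≤hi)

Unique-freeVertices : ∀ as hi → Sparse as → leadℕ as ≤ hi → Unique (freeVertices as hi)
Unique-freeVertices [] hi _ _ = Unique-interval 3 hi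
Unique-freeVertices (a ∷ as) hi (a-gap , sparse) _ =
  Uniqueₚ.++⁺ (Unique-interval (3 + a) hi) (Unique-freeVertices as (a ∸ 1) sparse (Sparse-tail a as a-gap)) disjoint
  where
  disjoint : ∀ {w} → ¬ (w ∈ interval (3 + a) hi × w ∈ freeVertices as (a ∸ 1))
  disjoint (p , q) = ℕₚ.<-irrefl refl (ℕₚ.<-≤-trans
    (ℕₚ.≤-trans (s≤s (proj₂ (∈-freeVertices⁻ as (a ∸ 1) sparse (Sparse-tail a as a-gap) q)))
      (ℕₚ.≤-trans (s≤s (ℕₚ.m∸n≤m a 1)) (ℕₚ.m≤n+m (suc a) 2)))
    (proj₁ (∈-interval⁻ (3 + a) hi p)))

hi≤length-freeVertices : ∀ as hi → hi ≤ length (freeVertices as hi) + 3 * length as + 2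
hi≤length-freeVertices [] hi = begin
  hi                                ≤⟨ ℕₚ.≤-pred (ℕₚ.m≤n+m∸n (suc hi) 3) ⟩
  2 + (suc hi ∸ 3)                  ≡⟨ cong (λ l → 2 + l) (sym (length-applyDownFrom (λ i → 3 + i) (suc hi ∸ 3))) ⟩
  2 + length (interval 3 hi)        ≡⟨ ℕₚ.+-comm 2 _ ⟩
  length (interval 3 hi) + 2        ≡⟨ cong (λ l → l + 2) (sym (ℕₚ.+-identityʳ _)) ⟩
  length (interval 3 hi) + 0 + 2    ∎
  where open ℕₚ.≤-Reasoning
hi≤length-freeVertices (a ∷ as) hi = begin
  hi                                          ≤⟨ ℕₚ.≤-pred (ℕₚ.m≤n+m∸n (suc hi) (3 + a)) ⟩
  2 + a + X                                   ≤⟨ ℕₚ.+-monoˡ-≤ X (ℕₚ.+-monoʳ-≤ 2 (ℕₚ.m≤n+m∸n a 1)) ⟩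
  2 + (1 + (a ∸ 1)) + X                       ≤⟨ ℕₚ.+-monoˡ-≤ X (ℕₚ.+-monoʳ-≤ 3 (hi≤length-freeVertices as (a ∸ 1))) ⟩
  3 + (L + 3 * length as + 2) + X             ≡⟨ rearrange X L (length as) ⟩
  X + L + 3 * suc (length as) + 2             ≡⟨ cong (λ l → l + L + 3 * suc (length as) + 2)
                                                   (sym (length-applyDownFrom (λ i → 3 + a + i) _)) ⟩
  length (interval (3 + a) hi) + L + 3 * length (a ∷ as) + 2
                                              ≡⟨ cong (λ l → l + 3 * length (a ∷ as) + 2)
                                                   (sym (length-++ (interval (3 + a) hi))) ⟩
  length (freeVertices (a ∷ as) hi) + 3 * length (a ∷ as) + 2 ∎
  where
  open ℕₚ.≤-Reasoning
  X L : ℕ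
  X = suc hi ∸ (3 + a)
  L = length (freeVertices as (a ∸ 1))
  rearrange : ∀ X L r → 3 + (L + 3 * r + 2) + X ≡ X + L + 3 * suc r + 2
  rearrange = solve-∀

pairAt : ∀ lo hi w → 3 + lo ≤ hi → lo ≤ w → w ≤ hi → ∃[ b ] lo ≤ b × 2 + b ≤ hi × (w ≡ b ⊎ w ≡ 2 + b)
pairAt lo hi w lo+3≤hi lo≤w w≤hi with 2 + w ℕ.≤? hi
... | yes w+2≤hi = w , lo≤w , w+2≤hi , inj₁ refl
... | no w+2≰hi = w ∸ 2 , ℕₚ.∸-monoˡ-≤ 2 lo+2≤w , subst (_≤ hi) (sym 2+[w∸2]≡w) w≤hi , inj₂ (sym 2+[w∸2]≡w)
  where
  lo+2≤w : 2 + lo ≤ w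
  lo+2≤w = ℕₚ.≤-pred (ℕₚ.≤-trans lo+3≤hi (ℕₚ.≤-pred (ℕₚ.≰⇒> w+2≰hi)))
  2+[w∸2]≡w : 2 + (w ∸ 2) ≡ w
  2+[w∸2]≡w = ℕₚ.m+[n∸m]≡n (ℕₚ.≤-trans (ℕₚ.m≤m+n 2 lo) lo+2≤w)

PairFaceThrough : List ℕ → ℕ → ℤ → Set
PairFaceThrough as hi v = Σ (List Pair) λ ps → Spaced ps × length ps ≡ suc (length as) × 2 + lead ps ≤ hi ×
                            v ∈ pairFace true ps × pairVertices as ⊆ pairFace true ps

pairFaceThrough : ∀ as hi → Sparse as → 6 + leadℕ as ≤ hi → ∀ {w} → w ∈ freeVertices as hi → ∀ ε →
                  PairFaceThrough as hi (signed ε (+ w))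
pairFaceThrough [] hi _ 6≤hi {w} w∈ ε with ∈-interval⁻ 3 hi w∈
... | 3≤w , w≤hi with pairAt 3 hi w 6≤hi 3≤w w≤hi
...   | b , 3≤b , b+2≤hi , inj₁ refl = (ε , b) ∷ [] , (3≤b , tt) , refl , b+2≤hi , there (here refl) , λ ()
...   | b , 3≤b , b+2≤hi , inj₂ refl = (ε , b) ∷ [] , (3≤b , tt) , refl , b+2≤hi , here refl , λ ()
pairFaceThrough (a ∷ as) hi (a-gap , sparse) a+6≤hi {w} w∈ ε with ∈-++⁻ (interval (3 + a) hi) w∈
... | inj₁ w∈above with ∈-interval⁻ (3 + a) hi w∈above
...   | a+3≤w , w≤hi with pairAt (3 + a) hi w a+6≤hi a+3≤w w≤hi
...     | b , a+3≤b , b+2≤hi , w≡ =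
  (ε , b) ∷ positive (a ∷ as) , (subst (λ l → 3 + l ≤ b) (sym (lead-positive (a ∷ as))) a+3≤b ,
                                 Sparse⇒Spaced (a ∷ as) (a-gap , sparse)) ,
  cong suc (length-map _ (a ∷ as)) , b+2≤hi , w∈F w≡ , there ∘ there ∘ pairVertices⊆pairFace (a ∷ as)
  where
  w∈F : w ≡ b ⊎ w ≡ 2 + b → signed ε (+ w) ∈ pairFace true ((ε , b) ∷ positive (a ∷ as))
  w∈F (inj₁ refl) = there (here refl)
  w∈F (inj₂ refl) = here refl
pairFaceThrough (a ∷ as) hi (a-gap , sparse) a+6≤hi w∈ ε | inj₂ w∈below
  with pairFaceThrough as (a ∸ 1) sparse (ℕₚ.∸-monoˡ-≤ 1 a-gap) w∈below ε
... | ps , spaced , |ps| , lead+2≤a-1 , w∈F , σ⊆F =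
  (true , a) ∷ ps , (lead+3≤a , spaced) , cong suc |ps| , ℕₚ.≤-trans (ℕₚ.m≤n+m (2 + a) 4) a+6≤hi ,
  there (there w∈F) , σ⊆F'
  where
  lead+3≤a : 3 + lead ps ≤ a
  lead+3≤a = subst (3 + lead ps ≤_) (ℕₚ.m+[n∸m]≡n (ℕₚ.≤-trans (s≤s z≤n) a-gap)) (s≤s lead+2≤a-1)
  σ⊆F' : pairVertices (a ∷ as) ⊆ pairFace true ((true , a) ∷ ps)
  σ⊆F' (here refl) = here refl
  σ⊆F' (there (here refl)) = there (here refl)
  σ⊆F' (there (there q)) = there (there (σ⊆F q))

freeVertex∉pairVertices : ∀ as hi → Sparse as → leadℕ as ≤ hi → ∀ {w} → w ∈ freeVertices as hi → ∀ ε →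
                          signed ε (+ w) ∉ pairVertices as
freeVertex∉pairVertices (a ∷ as) hi (a-gap , sparse) a≤hi {w} w∈ ε q with ∈-++⁻ (interval (3 + a) hi) w∈
... | inj₁ w∈above = ℕₚ.<-irrefl refl (ℕₚ.<-≤-trans
        (s≤s (subst (_≤ 2 + a) (∣signed∣ ε w) (All.lookup (pairVertices-≤ (a ∷ as) (a-gap , sparse)) q)))
        (proj₁ (∈-interval⁻ (3 + a) hi w∈above)))
... | inj₂ w∈below = excluded q
  where
  w≤a-1 : w ≤ a ∸ 1
  w≤a-1 = proj₂ (∈-freeVertices⁻ as (a ∸ 1) sparse (Sparse-tail a as a-gap) w∈below)
  w<a : w < a
  w<a = ℕₚ.≤-trans (s≤s w≤a-1) (ℕₚ.≤-reflexive (ℕₚ.m+[n∸m]≡n (ℕₚ.≤-trans (s≤s z≤n) a-gap)))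
  w≡ : ∀ {x} → signed ε (+ w) ≡ + x → w ≡ x
  w≡ e = trans (sym (∣signed∣ ε w)) (cong ∣_∣ e)
  excluded : signed ε (+ w) ∉ pairVertices (a ∷ as)
  excluded (here e) = ℕₚ.<⇒≱ w<a (subst (a ≤_) (sym (w≡ e)) (ℕₚ.m≤n+m a 2))
  excluded (there (here e)) = ℕₚ.<⇒≢ w<a (w≡ e)
  excluded (there (there q')) = freeVertex∉pairVertices as (a ∸ 1) sparse (Sparse-tail a as a-gap) w∈below ε q'

GoodFace : ℕ → ℕ → Face → Set
GoodFace k n σ = Λ k n σ × Unique σ × length σ ≡ (2 * k ∸ 2) ×
                 Σ (List ℤ) λ V → Unique V × 2 * (n ∸ (3 * k ∸ 1)) ≤ length V ×
                   All (λ v → lk σ (Λ k n) [ v ]) V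

∉[1,2] : ∀ {u} → 3 ≤ ∣ u ∣ → u ∉ + 1 ∷ + 2 ∷ []
∉[1,2] (s≤s ()) (here refl)
∉[1,2] (s≤s (s≤s ())) (there (here refl))

pairVertices∉[1,2] : ∀ as → Sparse as → ∀ v → v ∈ pairVertices as → v ∉ + 1 ∷ + 2 ∷ []
pairVertices∉[1,2] as sparse v v∈ = ∉[1,2] (All.lookup (pairVertices-≥3 as sparse) v∈)

pairVertices∈Λ : ∀ r n as → Sparse as → length as ≡ r → 6 + leadℕ as ≤ n → Λ (suc r) n (pairVertices as)
pairVertices∈Λ r n as sparse |as| lead+6≤n =
  pairVertices∉[1,2] as sparse ,
  ⊆pairFace⇒∈Δ r true ps (cong suc (trans (length-map _ as) |as|)) (lead+3≤n-2 , Sparse⇒Spaced as sparse)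
    n (ℕₚ.≤-reflexive (ℕₚ.m+[n∸m]≡n (ℕₚ.≤-trans (ℕₚ.m≤m+n 2 _) lead+6≤n))) σ∪[1,2]⊆F
  where
  ps : List Pair
  ps = (true , n ∸ 2) ∷ positive as
  lead+3≤n-2 : 3 + lead (positive as) ≤ n ∸ 2
  lead+3≤n-2 = subst (λ l → 3 + l ≤ n ∸ 2) (sym (lead-positive as))
                 (ℕₚ.∸-monoˡ-≤ 2 (ℕₚ.≤-trans (ℕₚ.n≤1+n _) lead+6≤n))
  σ∪[1,2]⊆F : pairVertices as ++ + 1 ∷ + 2 ∷ [] ⊆ pairFace true ps
  σ∪[1,2]⊆F q with ∈-++⁻ (pairVertices as) q
  ... | inj₁ q' = there (there (pairVertices⊆pairFace as q'))
  ... | inj₂ q' = [1,2]⊆pairFace ps q'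

freeVertex∈lk : ∀ r n as → Sparse as → length as ≡ r → 6 + leadℕ as ≤ n → ∀ {w} → w ∈ freeVertices as n → ∀ ε →
                lk (pairVertices as) (Λ (suc r) n) [ signed ε (+ w) ]
freeVertex∈lk r n as sparse |as| lead+6≤n {w} w∈ ε with pairFaceThrough as n sparse lead+6≤n w∈ ε
... | ps , spaced , |ps| , lead+2≤n , v∈F , σ⊆F =
  (λ { _ (here refl) → freeVertex∉pairVertices as n sparse (ℕₚ.≤-trans (ℕₚ.m≤n+m _ 6) lead+6≤n) w∈ ε }) ,
  v∪σ∉[1,2] , ⊆pairFace⇒∈Δ r true ps (trans |ps| (cong suc |as|)) spaced n lead+2≤n v∪σ∪[1,2]⊆F
  where
  v∪σ∉[1,2] : ∀ u → u ∈ signed ε (+ w) ∷ pairVertices as → u ∉ + 1 ∷ + 2 ∷ []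
  v∪σ∉[1,2] u (here refl) = ∉[1,2] (subst (3 ≤_) (sym (∣signed∣ ε w))
                              (proj₁ (∈-freeVertices⁻ as n sparse (ℕₚ.≤-trans (ℕₚ.m≤n+m _ 6) lead+6≤n) w∈)))
  v∪σ∉[1,2] u (there u∈) = pairVertices∉[1,2] as sparse u u∈
  v∪σ∪[1,2]⊆F : (signed ε (+ w) ∷ pairVertices as) ++ + 1 ∷ + 2 ∷ [] ⊆ pairFace true ps
  v∪σ∪[1,2]⊆F (here refl) = v∈F
  v∪σ∪[1,2]⊆F (there q) with ∈-++⁻ (pairVertices as) q
  ... | inj₁ q' = σ⊆F q'
  ... | inj₂ q' = [1,2]⊆pairFace ps q'

linkVertices : List ℕ → List ℤ
linkVertices W = map +_ W ++ map (-_ ∘ +_) W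

Unique-linkVertices : ∀ {W} → 0 ∉ W → Unique W → Unique (linkVertices W)
Unique-linkVertices {W} 0∉W uW =
  Uniqueₚ.++⁺ (Uniqueₚ.map⁺ ℤₚ.+-injective uW) (Uniqueₚ.map⁺ (ℤₚ.+-injective ∘ ℤₚ.neg-injective) uW) disjoint
  where
  disjoint : ∀ {v} → ¬ (v ∈ map +_ _ × v ∈ map (-_ ∘ +_) _)
  disjoint (p , q) with ∈-map⁻ +_ p | ∈-map⁻ (-_ ∘ +_) q
  ... | w , _ , refl | zero , 0∈W , _ = 0∉W 0∈W

length-linkVertices : ∀ W → length (linkVertices W) ≡ length W + length W
length-linkVertices W = trans (length-++ (map +_ W)) (cong₂ _+_ (length-map +_ W) (length-map (-_ ∘ +_) W))

goodFace : ∀ r n as → Sparse as → length as ≡ r → 6 + leadℕ as ≤ n → GoodFace (suc r) n (pairVertices as)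
goodFace r n as sparse |as| lead+6≤n =
  pairVertices∈Λ r n as sparse |as| lead+6≤n ,
  Decreasing⇒Unique (pairVertices-decreasing as sparse) ,
  trans (length-pairVertices as) (trans (cong double |as|) (sym (cong (_∸ 2) (2*≡double (suc r))))) ,
  linkVertices W , Unique-linkVertices 0∉W (Unique-freeVertices as n sparse lead≤n) , enough , All.tabulate inLink
  where
  W : List ℕ
  W = freeVertices as n
  lead≤n : leadℕ as ≤ n
  lead≤n = ℕₚ.≤-trans (ℕₚ.m≤n+m _ 6) lead+6≤n
  0∉W : 0 ∉ W
  0∉W 0∈W = ℕₚ.<⇒≱ z<s (proj₁ (∈-freeVertices⁻ as n sparse lead≤n 0∈W))
  3*suc∸1 : 3 * suc r ∸ 1 ≡ 3 * r + 2
  3*suc∸1 = trans (cong (_∸ 1) (ℕₚ.*-suc 3 r)) (ℕₚ.+-comm 2 (3 * r))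
  n∸≤|W| : n ∸ (3 * r + 2) ≤ length W
  n∸≤|W| = ℕₚ.m≤n+o⇒m∸n≤o n (3 * r + 2)
    (subst (n ≤_) (swap (length W) r) (subst (λ l → n ≤ length W + 3 * l + 2) |as| (hi≤length-freeVertices as n)))
    where
    swap : ∀ x r → x + 3 * r + 2 ≡ 3 * r + 2 + x
    swap = solve-∀
  enough : 2 * (n ∸ (3 * suc r ∸ 1)) ≤ length (linkVertices W)
  enough = subst₂ _≤_ (trans (double≡ (n ∸ (3 * r + 2))) (cong (λ m → 2 * (n ∸ m)) (sym 3*suc∸1))) (sym (length-linkVertices W))
                  (ℕₚ.+-mono-≤ n∸≤|W| n∸≤|W|)
    where
    double≡ : ∀ x → x + x ≡ 2 * x
    double≡ = solve-∀
  inLink : ∀ {v} → v ∈ linkVertices W → lk (pairVertices as) (Λ (suc r) n) [ v ]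
  inLink q with ∈-++⁻ (map +_ W) q
  ... | inj₁ q' with ∈-map⁻ +_ q'
  ...   | w , w∈ , refl = freeVertex∈lk r n as sparse |as| lead+6≤n w∈ true
  inLink q | inj₂ q' with ∈-map⁻ (-_ ∘ +_) q'
  ...   | w , w∈ , refl = freeVertex∈lk r n as sparse |as| lead+6≤n w∈ false

Decreasing-≋⇒≡ : ∀ {U V} → Decreasing U → Decreasing V → U ≋ V → U ≡ V
Decreasing-≋⇒≡ {[]} {[]} _ _ _ = refl
Decreasing-≋⇒≡ {[]} {v ∷ V} _ _ (_ , V⊆[]) with V⊆[] (here refl)
... | ()
Decreasing-≋⇒≡ {u ∷ U} {[]} _ _ (U⊆[] , _) with U⊆[] (here refl)
... | ()
Decreasing-≋⇒≡ {u ∷ U} {v ∷ V} (u>U ∷ dU) (v>V ∷ dV) (u∷U⊆ , v∷V⊆) =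
  cong₂ _∷_ u≡v (Decreasing-≋⇒≡ dU dV (shrink u>U (subst (λ x → u ∷ U ⊆ x ∷ V) (sym u≡v) u∷U⊆) ,
                                       shrink v>V (subst (λ x → v ∷ V ⊆ x ∷ U) u≡v v∷V⊆)))
  where
  u≡v : u ≡ v
  u≡v with u∷U⊆ (here refl) | v∷V⊆ (here refl)
  ... | here u≡v | _ = u≡v
  ... | there _ | here v≡u = sym v≡u
  ... | there u∈V | there v∈U = ⊥-elim (ℕₚ.<-asym (All.lookup v>V u∈V) (All.lookup u>U v∈U))
  shrink : ∀ {x X Y} → All (λ y → ∣ y ∣ < ∣ x ∣) X → x ∷ X ⊆ x ∷ Y → X ⊆ Y
  shrink x>X ⊆ y∈X with ⊆ (there y∈X)
  ... | here refl = ⊥-elim (ℕₚ.<-irrefl refl (All.lookup x>X y∈X))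
  ... | there y∈Y = y∈Y

pairVertices-injective : ∀ x y → pairVertices x ≡ pairVertices y → x ≡ y
pairVertices-injective [] [] _ = refl
pairVertices-injective [] (_ ∷ _) ()
pairVertices-injective (_ ∷ _) [] ()
pairVertices-injective (a ∷ x) (b ∷ y) eq with ∷-injective (proj₂ (∷-injective eq))
... | +a≡+b , eq' = cong₂ _∷_ (ℤₚ.+-injective +a≡+b) (pairVertices-injective x y eq')

AllPairs-weaken : ∀ {A : Set} {P : A → Set} {R S : A → A → Set} → (∀ {x y} → P x → P y → R x y → S x y) →
                  ∀ {xs} → All P xs → AllPairs R xs → AllPairs S xs
AllPairs-weaken f [] [] = []
AllPairs-weaken f (px ∷ pxs) (rx ∷ rxs) =
  All.zipWith (λ { (py , r) → f px py r }) (pxs , rx) ∷ AllPairs-weaken f pxs rxs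

length-cartesianProductWith : ∀ {A B C : Set} (f : A → B → C) xs ys →
                              length (cartesianProductWith f xs ys) ≡ length xs * length ys
length-cartesianProductWith f [] ys = refl
length-cartesianProductWith f (x ∷ xs) ys =
  trans (length-++ (map (f x) ys)) (cong₂ _+_ (length-map (f x) ys) (length-cartesianProductWith f xs ys))

-- The entry at position i from the end is chosen from the block {7 + 7 (i L + j) : j < L}.
sparseLists : ℕ → ℕ → List (List ℕ)
sparseLists L zero = [] ∷ []
sparseLists L (suc r) = cartesianProductWith (λ j s → 7 + 7 * (r * L + j) ∷ s) (upTo L) (sparseLists L r)

length-sparseLists : ∀ L r → length (sparseLists L r) ≡ L ^ r
length-sparseLists L zero = refl
length-sparseLists L (suc r) = trans (length-cartesianProductWith _ (upTo L) (sparseLists L r))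
                                 (cong₂ _*_ (length-upTo L) (length-sparseLists L r))

Unique-sparseLists : ∀ L r → Unique (sparseLists L r)
Unique-sparseLists L zero = [] ∷ []
Unique-sparseLists L (suc r) =
  Uniqueₚ.cartesianProductWith⁺ _ injective (Uniqueₚ.upTo⁺ L) (Unique-sparseLists L r)
  where
  injective : ∀ {i j s t} → 7 + 7 * (r * L + i) ∷ s ≡ 7 + 7 * (r * L + j) ∷ t → i ≡ j × s ≡ t
  injective {i} {j} eq with ∷-injective eq
  ... | head≡ , s≡t = ℕₚ.+-cancelˡ-≡ (r * L) i j (ℕₚ.*-cancelˡ-≡ _ _ 7 (ℕₚ.+-cancelˡ-≡ 7 _ _ head≡)) , s≡t

sparseLists-sparse : ∀ L r → All (λ s → Sparse s × leadℕ s ≤ 7 * (r * L) × length s ≡ r) (sparseLists L r)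
sparseLists-sparse L zero = (tt , z≤n , refl) ∷ []
sparseLists-sparse L (suc r) = All.tabulate λ q → extend (∈-cartesianProductWith⁻ _ (upTo L) (sparseLists L r) q)
  where
  extend : ∀ {s} → ∃[ j ] ∃[ t ] j ∈ upTo L × t ∈ sparseLists L r × s ≡ 7 + 7 * (r * L + j) ∷ t →
           Sparse s × leadℕ s ≤ 7 * (suc r * L) × length s ≡ suc r
  extend (j , t , j∈ , t∈ , refl) with All.lookup (sparseLists-sparse L r) t∈
  ... | sparse , lead≤ , |t| =
    (ℕₚ.+-monoʳ-≤ 7 (ℕₚ.≤-trans lead≤ (ℕₚ.*-monoʳ-≤ 7 (ℕₚ.m≤m+n (r * L) j))) , sparse) ,
    subst (_≤ 7 * (suc r * L)) (ℕₚ.*-suc 7 (r * L + j))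
      (ℕₚ.*-monoʳ-≤ 7 (subst (_≤ L + r * L) (ℕₚ.+-suc (r * L) j)
        (subst (r * L + suc j ≤_) (ℕₚ.+-comm (r * L) L) (ℕₚ.+-monoʳ-≤ (r * L) (∈-upTo⁻ j∈))))) ,
    cong suc |t|

manyGoodFaces : ∀ r n L → 7 * (r * L) + 6 ≤ n →
  Σ (List Face) λ Fs → AllPairs (λ σ τ → ¬ (σ ≋ τ)) Fs × length Fs ≡ L ^ r × All (GoodFace (suc r) n) Fs
manyGoodFaces r n L fits =
  map pairVertices S ,
  AllPairsₚ.map⁺ (AllPairs-weaken distinct (All.map proj₁ (sparseLists-sparse L r)) (Unique-sparseLists L r)) ,
  trans (length-map pairVertices S) (length-sparseLists L r) ,
  Allₚ.map⁺ (All.map good (sparseLists-sparse L r))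
  where
  S : List (List ℕ)
  S = sparseLists L r
  distinct : ∀ {x y} → Sparse x → Sparse y → x ≢ y → ¬ (pairVertices x ≋ pairVertices y)
  distinct {x} {y} sx sy x≢y σ≋τ = x≢y (pairVertices-injective x y
    (Decreasing-≋⇒≡ (pairVertices-decreasing x sx) (pairVertices-decreasing y sy) σ≋τ))
  good : ∀ {s} → Sparse s × leadℕ s ≤ 7 * (r * L) × length s ≡ r → GoodFace (suc r) n (pairVertices s)
  good {s} (sparse , lead≤ , |s|) =
    goodFace r n s sparse |s| (ℕₚ.≤-trans (ℕₚ.+-monoʳ-≤ 6 lead≤) (subst (_≤ n) (ℕₚ.+-comm _ 6) fits))

[m*n]^o≡m^o*n^o : ∀ m n o → (m * n) ^ o ≡ m ^ o * n ^ o
[m*n]^o≡m^o*n^o m n zero = refl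
[m*n]^o≡m^o*n^o m n (suc o) = trans (cong (m * n *_) ([m*n]^o≡m^o*n^o m n o)) (swap m n (m ^ o) (n ^ o))
  where
  swap : ∀ a b c d → a * b * (c * d) ≡ a * c * (b * d)
  swap = solve-∀

blockCount-bounds : ∀ r n → 14 * suc r ≤ n →
                    7 * (suc r * (n / (14 * suc r))) + 6 ≤ n × n ≤ 28 * suc r * (n / (14 * suc r))
blockCount-bounds r n d≤n = ℕₚ.<⇒≤ fits , n≤28rL
  where
  open ℕₚ.≤-Reasoning
  d L : ℕ
  d = 14 * suc r
  L = n / d
  Ld≡ : L * d ≡ 7 * (suc r * L) + 7 * (suc r * L)
  Ld≡ = identity L r
    where
    identity : ∀ L r → L * (14 * suc r) ≡ 7 * (suc r * L) + 7 * (suc r * L)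
    identity = solve-∀
  1≤L : 1 ≤ L
  1≤L = m≥n⇒m/n>0 d≤n
  fits : 7 * (suc r * L) + 6 < n
  fits = begin-strict
    7 * (suc r * L) + 6                   <⟨ ℕₚ.+-monoʳ-< (7 * (suc r * L)) (ℕₚ.*-monoʳ-≤ 7 (ℕₚ.*-mono-≤ {1} {suc r} (s≤s z≤n) 1≤L)) ⟩
    7 * (suc r * L) + 7 * (suc r * L)     ≡⟨ sym Ld≡ ⟩
    L * d                                 ≤⟨ m/n*n≤m n d ⟩
    n                                     ∎
  n≤28rL : n ≤ 28 * suc r * L
  n≤28rL = begin
    n                  ≡⟨ m≡m%n+[m/n]*n n d ⟩
    n % d + L * d      ≤⟨ ℕₚ.+-monoˡ-≤ (L * d) (ℕₚ.<⇒≤ (m%n<n n d)) ⟩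
    d + L * d          ≤⟨ ℕₚ.+-monoˡ-≤ (L * d) (subst (_≤ L * d) (ℕₚ.*-identityˡ d) (ℕₚ.*-monoˡ-≤ d 1≤L)) ⟩
    L * d + L * d      ≡⟨ identity L r ⟩
    28 * suc r * L     ∎
    where
    identity : ∀ L r → L * (14 * suc r) + L * (14 * suc r) ≡ 28 * suc r * L
    identity = solve-∀

lemma5p8 : (k : ℕ) → 2 ≤ k →
    Σ ℕ λ a → Σ ℕ λ b → 0 < a × 0 < b × Σ ℕ λ N → (n : ℕ) → N ≤ n →
      Σ (List Face) λ L →
        AllPairs (λ σ τ → ¬ (σ ≋ τ)) L ×
        a * n ^ (k ∸ 1) ≤ b * length L ×
        All (λ σ → Λ k n σ × Unique σ × length σ ≡ (2 * k ∸ 2) ×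
               Σ (List ℤ) λ V → Unique V × 2 * (n ∸ (3 * k ∸ 1)) ≤ length V ×
                 All (λ v → lk σ (Λ k n) [ v ]) V) L
lemma5p8 (suc zero) (s≤s ())
lemma5p8 (suc (suc r)) _ =
  1 , c ^ suc r , z<s , ℕₚ.m^n>0 c (suc r) , 14 * suc r , λ n 14r≤n →
    let fits , n≤cL = blockCount-bounds r n 14r≤n
        Fs , distinct , |Fs| , good = manyGoodFaces (suc r) n (n / (14 * suc r)) fits
    in Fs , distinct , counted n (n / (14 * suc r)) n≤cL |Fs| , good
  where
  c : ℕ
  c = 28 * suc r
  counted : ∀ n L {l} → n ≤ c * L → l ≡ L ^ suc r → 1 * n ^ suc r ≤ c ^ suc r * l
  counted n L n≤cL refl = begin
    1 * n ^ suc r          ≡⟨ ℕₚ.*-identityˡ _ ⟩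
    n ^ suc r              ≤⟨ ℕₚ.^-monoˡ-≤ (suc r) n≤cL ⟩
    (c * L) ^ suc r        ≡⟨ [m*n]^o≡m^o*n^o c L (suc r) ⟩
    c ^ suc r * L ^ suc r  ∎
    where open ℕₚ.≤-Reasoning
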